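{- Let $X$ be a finite set with $|X|\ge 3$ and let $T_1,T_2$ be $X$-trees. Then $\mathbb M(T_1)=\mathbb M(T_2)$ if and only if $T_1\simeq T_2$.
   Context: An $X$-tree is a finite tree $T=(V,E)$ with leaf set $X\subseteq V$ and no vertices of degree 2. Two $X$-trees $T_1=(V_1,E_1)$, $T_2=(V_2,E_2)$ are equivalent, $T_1\simeq T_2$, if there is a bijection $\varphi:V_1\to V_2$ with $\varphi(x)=x$ for all $x\in X$ and $E_2=\{\{\varphi(u),\varphi(v)\}:\{u,v\}\in E_1\}$. A cord is a 2-subset $xy$ of $X$. For an $X$-tree $T=(V,E)$ and a cord $xy$, $\lambda^T_{xy}:\mathbb R^E\to\mathbb R$ is $\omega\mapsto\sum_{e\in E(x|y)}\omega(e)$, where $E(x|y)$ is the set of edges on the path from $x$ to $y$. $\mathbb M(T)$ is the matroid on ground set $\binom{X}{2}$ with rank function $\operatorname{rk}^T(\mathcal L)=\dim\operatorname{span}\{\lambda^T_{xy}:xy\in\mathcal L\}$. -}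

module Defs where

open import Data.Nat using (ℕ; zero; suc; _+_; _≤_)
open import Data.Fin using (Fin; _<_)
open import Data.Fin.Properties using () renaming (_≟_ to _≟ᶠ_)
open import Data.Fin.Base using (toℕ)
open import Data.List using (List; []; _∷_; map; _++_; foldr; length; all)
open import Data.List.Base using (allFin)
open import Data.List.Membership.Propositional using (_∈_)
open import Data.List.Relation.Unary.Unique.Propositional using (Unique)
open import Data.Sum using (_⊎_; inj₁; inj₂)
open import Data.Sum.Properties using (≡-dec)
open import Data.Product using (Σ; _×_; _,_; proj₁; ∃)
open import Data.Bool using (Bool; true; false; if_then_else_; _∨_; _∧_)
open import Data.Rational using (ℚ; 0ℚ; 1ℚ) renaming (_+_ to _+ℚ_; _*_ to _*ℚ_)
open import Relation.Binary.PropositionalEquality using (_≡_; _≢_)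
open import Relation.Nullary.Decidable using (⌊_⌋)
open import Function.Bundles using (_⤖_; Bijection)

-- The leaf set X is Fin n.  An X-tree has vertex set  Fin n ⊎ Fin k :
-- inj₁ x is the leaf x ∈ X, inj₂ i are the k interior vertices.

Vtx : ℕ → ℕ → Set
Vtx n k = Fin n ⊎ Fin k

_≟v_ : ∀ {n k} → (u v : Vtx n k) → _
_≟v_ = ≡-dec _≟ᶠ_ _≟ᶠ_

allVtx : ∀ n k → List (Vtx n k)
allVtx n k = map inj₁ (allFin n) ++ map inj₂ (allFin k)

data IsWalk {V : Set} (adj : V → V → Bool) : V → V → List V → Set where
  walk-one  : ∀ {u} → IsWalk adj u u (u ∷ [])
  walk-cons : ∀ {u w v ws} → adj u w ≡ true → IsWalk adj w v ws →
              IsWalk adj u v (u ∷ ws)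

IsPath : {V : Set} (adj : V → V → Bool) → V → V → List V → Set
IsPath adj u v p = IsWalk adj u v p × Unique p

deg : ∀ {n k} → (Vtx n k → Vtx n k → Bool) → Vtx n k → ℕ
deg {n} {k} adj v = foldr _+_ 0 (map (λ w → if adj v w then 1 else 0) (allVtx n k))

record XTree (n : ℕ) : Set where
  field
    k       : ℕ
    adj     : Vtx n k → Vtx n k → Bool
    sym     : ∀ u v → adj u v ≡ adj v u
    irrefl  : ∀ u → adj u u ≡ false
    path    : ∀ u v → List (Vtx n k)
    path-ok : ∀ u v → IsPath adj u v (path u v)
    path-unique : ∀ u v q → IsPath adj u v q → q ≡ path u v
    leaf-deg : ∀ x → deg adj (inj₁ x) ≡ 1
    deg1-leaf : ∀ v → deg adj v ≡ 1 → ∃ λ x → v ≡ inj₁ x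
    no-deg2 : ∀ v → deg adj v ≢ 2
open XTree public

_≃T_ : ∀ {n} → XTree n → XTree n → Set
_≃T_ {n} T₁ T₂ =
  Σ (Vtx n (k T₁) ⤖ Vtx n (k T₂)) λ φ →
    (∀ x → Bijection.to φ (inj₁ x) ≡ inj₁ x) ×
    (∀ u v → adj T₂ (Bijection.to φ u) (Bijection.to φ v) ≡ adj T₁ u v)

-- Cords: 2-subsets {x,y} of X, represented as x < y.
Cord : ℕ → Set
Cord n = Σ (Fin n × Fin n) λ { (x , y) → x < y }

onList : ∀ {n k} → Vtx n k → Vtx n k → List (Vtx n k) → Bool
onList a b [] = false
onList a b (u ∷ []) = false
onList a b (u ∷ w ∷ ws) =
  (⌊ a ≟v u ⌋ ∧ ⌊ b ≟v w ⌋) ∨ (⌊ b ≟v u ⌋ ∧ ⌊ a ≟v w ⌋) ∨ onList a b (w ∷ ws)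

-- λ^T_{xy}(e) : the coefficient of the edge e = {a,b} in λ_xy
-- (1 if e ∈ E(x|y), 0 otherwise), as a rational number.
lam : ∀ {n} (T : XTree n) → Cord n → Vtx n (k T) → Vtx n (k T) → ℚ
lam T ((x , y) , _) a b =
  if onList a b (path T (inj₁ x) (inj₁ y)) then 1ℚ else 0ℚ

sumℚ : List ℚ → ℚ
sumℚ = foldr _+ℚ_ 0ℚ

-- A duplicate-free list I of cords is independent in M(T): the functionals
-- λ^T_{xy} (xy ∈ I) are linearly independent, i.e. every linear relation
-- Σ c_xy λ_xy = 0 (tested on every edge e = {a,b} of T) is trivial.
Independent : ∀ {n} → XTree n → List (Cord n) → Set
Independent {n} T I =
  Unique I ×
  ((c : Cord n → ℚ) →
     (∀ a b → adj T a b ≡ true →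
        sumℚ (map (λ xy → c xy *ℚ lam T xy a b) I) ≡ 0ℚ) →
     ∀ xy → xy ∈ I → c xy ≡ 0ℚ)

HasRank : ∀ {n} → XTree n → (Cord n → Bool) → ℕ → Set
HasRank {n} T L r =
  (Σ (List (Cord n)) λ I → (∀ xy → xy ∈ I → L xy ≡ true) × Independent T I × length I ≡ r) ×
  (∀ (I : List (Cord n)) → (∀ xy → xy ∈ I → L xy ≡ true) → Independent T I → length I ≤ r)

SameMatroid : ∀ {n} → XTree n → XTree n → Set
SameMatroid T₁ T₂ = ∀ L r → (HasRank T₁ L r → HasRank T₂ L r) × (HasRank T₂ L r → HasRank T₁ L r)

{-# OPTIONS --safe #-}
-- For distinct leaves a, b, c, d the functionals λ_ac, λ_ad, λ_bc, λ_bd are linearly independent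
-- exactly when some edge separates {a, c} from {b, d} or {a, d} from {b, c}: the pendant edges and such
-- an edge force every linear relation to vanish, and otherwise λ_ac − λ_ad − λ_bc + λ_bd = 0.  Hence
-- M(T) determines which pairs of leaves are joined by vertex-disjoint paths, and this determines T.
-- A vertex is characterised by the leaf pairs whose path passes through it; an interior vertex is the
-- median of three leaves in different branches at it, and a leaf path passes through that median iff
-- it meets the three paths between these leaves.  Matching medians therefore gives a bijection between
-- the vertex sets that preserves these characterisations, and it preserves adjacency because u and v
-- are adjacent iff every other vertex is avoided by some leaf path through both.  Conversely, an
-- equivalence maps paths to paths and so preserves every λ_xy.

module Submission where

open import Defs using (XTree; module XTree; Vtx; _≟v_; allVtx; IsWalk; walk-one; walk-cons; IsPath; deg; Cord; onList; lam; sumℚ; Independent; HasRank; SameMatroid; _≃T_)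
open import Data.Nat using (ℕ; zero; suc; _+_; _≤_; _<_; s≤s; z<s)
open import Data.Nat.Properties using (m≤m+n; m<m+n; m<n+m; <⇒≱; ≤-trans; ≤-reflexive; +-identityʳ; +-suc)
open import Data.Fin using (Fin; zero) renaming (_≟_ to _≟ᶠ_)
open import Data.Fin.Properties using (<-cmp; <-irrelevant)
open import Data.List using (List; []; _∷_; _++_; [_]; map; length; reverse; foldr; filter; allFin; initLast; _∷ʳ′_)
open import Data.List.Properties using (++-assoc; ++-identityʳ; length-++; unfold-reverse; ∷-injectiveˡ; ∷-injectiveʳ; ∷ʳ-injectiveˡ; map-cong)
open import Data.List.Membership.Propositional using (_∈_; _∉_; find; lose)
open import Data.List.Membership.Propositional.Properties using (∈-++⁺ˡ; ∈-++⁺ʳ; ∈-++⁻; ∈-∃++; ∈-map⁺; ∈-map⁻; ∈-allFin; ∈-filter⁺; ∈-filter⁻)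
open import Data.List.Membership.DecPropositional using () renaming (_∈?_ to member?)
open import Data.List.Relation.Unary.Any using (here; there; any?)
open import Data.List.Relation.Unary.Any.Properties using () renaming (reverse⁺ to ∈-reverse⁺; reverse⁻ to ∈-reverse⁻)
open import Data.List.Relation.Unary.All as All using (All; []; _∷_)
open import Data.List.Relation.Unary.All.Properties using (¬Any⇒All¬; All¬⇒¬Any) renaming (++⁻ˡ to All-++⁻ˡ; ++⁻ʳ to All-++⁻ʳ)
open import Data.List.Relation.Unary.AllPairs using ([]; _∷_)
open import Data.List.Relation.Unary.Unique.Propositional using (Unique)
open import Data.List.Relation.Unary.Unique.Propositional.Properties using (++⁺; map⁺; allFin⁺; filter⁺)
import Data.List.Relation.Unary.First as First
open import Data.List.Relation.Unary.First.Properties using (toView)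
open import Data.List.Relation.Binary.Subset.Propositional using (_⊆_)
open import Data.List.Relation.Binary.Subset.Propositional.Properties using (∷⁺ʳ)
open import Data.List.Relation.Binary.Disjoint.Propositional using (Disjoint)
open import Data.List.Relation.Binary.Disjoint.Propositional.Properties using () renaming (sym to Disjoint-sym)
open import Data.List.Relation.Binary.Permutation.Propositional using (_↭_; ↭-refl; ↭-sym; ↭-trans; prep; ↭⇒↭ₛ)
open import Data.List.Relation.Binary.Permutation.Propositional.Properties using (shift; ↭-length; ∈-resp-↭; ↭-reverse) renaming (map⁺ to ↭-map⁺)
import Data.List.Relation.Binary.Permutation.Setoid.Properties as Permₛ
open import Data.Sum as Sum using (_⊎_; inj₁; inj₂; [_,_]′)
open import Data.Sum.Properties using (inj₁-injective; inj₂-injective)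
open import Data.Product as Product using (Σ; _×_; _,_; proj₁; proj₂; ∃; ∃₂)
open import Data.Bool using (Bool; true; false; if_then_else_; _∧_; _∨_; _xor_) renaming (_≟_ to _≟ᵇ_)
open import Data.Bool.Properties using (∨-zeroʳ; ∧-zeroʳ; ∨-assoc; ∨-comm; xor-comm)
open import Data.Rational using (ℚ; 0ℚ; 1ℚ; ½) renaming (_+_ to _+ℚ_; _*_ to _*ℚ_; -_ to -ℚ_; _-_ to _-ℚ_)
open import Data.Rational.Properties using (+-identityˡ; *-comm; 1≢0; +-0-commutativeMonoid)
open import Data.Rational.Solver using (module +-*-Solver)
open import Data.Empty using (⊥; ⊥-elim)
open import Relation.Nullary using (¬_; yes; no; does; ¬?; _×-dec_)
open import Relation.Nullary.Decidable using (⌊_⌋; dec-true; dec-false)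
open import Relation.Binary.Definitions using (DecidableEquality; tri<; tri≈; tri>)
open import Relation.Binary.PropositionalEquality using (_≡_; _≢_; refl; sym; trans; cong; cong₂; subst; subst₂; setoid; ≢-sym; module ≡-Reasoning)
open import Function using (_∘_; _∘₂_)
open import Function.Bundles using (Bijection; mk↔ₛ′)
open import Function.Properties.Inverse using (↔⇒⤖)
open import Algebra.Bundles using (CommutativeMonoid)
open import Data.Product.Properties using (≡-dec)

module _ {A : Set} where

  Unique-⊆⇒++-↭ : {xs ys : List A} → Unique xs → xs ⊆ ys → ∃ λ zs → xs ++ zs ↭ ys
  Unique-⊆⇒++-↭ {[]} {ys} _ _ = ys , ↭-refl
  Unique-⊆⇒++-↭ {x ∷ xs} (x∉xs ∷ !xs) x∷xs⊆ys with ∈-∃++ (x∷xs⊆ys (here refl))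
  ... | us , vs , refl with Unique-⊆⇒++-↭ !xs xs⊆us++vs
    where
    xs⊆us++vs : xs ⊆ us ++ vs
    xs⊆us++vs {z} z∈xs with ∈-resp-↭ (shift x us vs) (x∷xs⊆ys (there z∈xs))
    ... | here refl = ⊥-elim (All.lookup x∉xs z∈xs refl)
    ... | there z∈us++vs = z∈us++vs
  ... | zs , xs++zs↭us++vs = zs , ↭-trans (prep x xs++zs↭us++vs) (↭-sym (shift x us vs))

  Unique-⊆⇒length≤ : {xs ys : List A} → Unique xs → xs ⊆ ys → length xs ≤ length ys
  Unique-⊆⇒length≤ {xs} !xs xs⊆ys with Unique-⊆⇒++-↭ !xs xs⊆ys
  ... | zs , p = ≤-trans (m≤m+n (length xs) (length zs))
                   (≤-reflexive (trans (sym (length-++ xs)) (↭-length p)))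

  Unique-⊆-length≤⇒↭ : {xs ys : List A} → Unique xs → xs ⊆ ys → length ys ≤ length xs → xs ↭ ys
  Unique-⊆-length≤⇒↭ {xs} {ys} !xs xs⊆ys ys≤xs with Unique-⊆⇒++-↭ !xs xs⊆ys
  ... | [] , p = subst (_↭ _) (++-identityʳ xs) p
  ... | z ∷ zs , p = ⊥-elim (<⇒≱ xs<ys ys≤xs)
    where
    xs<ys : length xs < length ys
    xs<ys = subst (length xs <_) (trans (sym (length-++ xs)) (↭-length p)) (m<m+n (length xs) z<s)

  Unique-reverse : {xs : List A} → Unique xs → Unique (reverse xs)
  Unique-reverse {xs} = Permₛ.Unique-resp-↭ (setoid A) (↭⇒↭ₛ (↭-sym (↭-reverse xs)))

  Unique-++⁻ˡ : (xs : List A) {ys : List A} → Unique (xs ++ ys) → Unique xs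
  Unique-++⁻ˡ [] _ = []
  Unique-++⁻ˡ (x ∷ xs) (x∉ ∷ !xs++ys) = All-++⁻ˡ xs x∉ ∷ Unique-++⁻ˡ xs !xs++ys

  Unique-++⁻ʳ : (xs : List A) {ys : List A} → Unique (xs ++ ys) → Unique ys
  Unique-++⁻ʳ [] !ys = !ys
  Unique-++⁻ʳ (x ∷ xs) (_ ∷ !xs++ys) = Unique-++⁻ʳ xs !xs++ys

  Unique-++⇒Disjoint : (xs : List A) {ys : List A} → Unique (xs ++ ys) → Disjoint xs ys
  Unique-++⇒Disjoint (x ∷ xs) (x∉ ∷ _) (here refl , x∈ys) = All.lookup (All-++⁻ʳ xs x∉) x∈ys refl
  Unique-++⇒Disjoint (x ∷ xs) (_ ∷ !xs++ys) (there v∈xs , v∈ys) = Unique-++⇒Disjoint xs !xs++ys (v∈xs , v∈ys)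

  disjoint-or-meet : DecidableEquality A → ∀ xs ys → Disjoint xs ys ⊎ ∃ λ v → v ∈ xs × v ∈ ys
  disjoint-or-meet _≟_ xs ys with any? (λ x → member? _≟_ x ys) xs
  ... | yes found = inj₂ (find found)
  ... | no none = inj₁ λ (v∈xs , v∈ys) → none (lose v∈xs v∈ys)

  first-common : DecidableEquality A → ∀ xs ys {z} → z ∈ xs → z ∈ ys →
    ∃₂ λ pre t → ∃ λ post → xs ≡ pre ++ t ∷ post × All (_∉ ys) pre × t ∈ ys
  first-common _≟_ xs ys z∈xs z∈ys with First.first ∉⊎∈ xs
    where
    ∉⊎∈ : ∀ x → x ∉ ys ⊎ x ∈ ys
    ∉⊎∈ x with member? _≟_ x ys
    ... | yes x∈ys = inj₂ x∈ys
    ... | no x∉ys = inj₁ x∉ys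
  ... | inj₂ none = ⊥-elim (All.lookup none z∈xs z∈ys)
  ... | inj₁ found with toView found
  ...   | First._++_∷_ pre∉ys t∈ys post = _ , _ , post , refl , pre∉ys , t∈ys

  ones≡length-filter : (f : A → Bool) (xs : List A) →
    foldr _+_ 0 (map (λ x → if f x then 1 else 0) xs) ≡ length (filter (λ x → f x ≟ᵇ true) xs)
  ones≡length-filter f [] = refl
  ones≡length-filter f (x ∷ xs) with f x
  ... | true = cong suc (ones≡length-filter f xs)
  ... | false = ones≡length-filter f xs

Bool-pairing : ∀ {a b c d : Bool} → a ≢ b → c ≢ d → (a ≡ c × b ≡ d) ⊎ (a ≡ d × b ≡ c)
Bool-pairing {false} {false} a≢b _ = ⊥-elim (a≢b refl)
Bool-pairing {true} {true} a≢b _ = ⊥-elim (a≢b refl)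
Bool-pairing {_} {_} {false} {false} _ c≢d = ⊥-elim (c≢d refl)
Bool-pairing {_} {_} {true} {true} _ c≢d = ⊥-elim (c≢d refl)
Bool-pairing {false} {true} {false} {true} _ _ = inj₁ (refl , refl)
Bool-pairing {false} {true} {true} {false} _ _ = inj₂ (refl , refl)
Bool-pairing {true} {false} {true} {false} _ _ = inj₁ (refl , refl)
Bool-pairing {true} {false} {false} {true} _ _ = inj₂ (refl , refl)

Bool-ext : ∀ {x y : Bool} → (x ≡ true → y ≡ true) → (y ≡ true → x ≡ true) → x ≡ y
Bool-ext {false} {false} _ _ = refl
Bool-ext {false} {true} _ y⇒x = y⇒x refl
Bool-ext {true} {false} x⇒y _ = sym (x⇒y refl)
Bool-ext {true} {true} _ _ = refl

module _ where
  open +-*-Solver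

  triangle-zero : ∀ {x y z} → x +ℚ y ≡ 0ℚ → x +ℚ z ≡ 0ℚ → y +ℚ z ≡ 0ℚ → x ≡ 0ℚ
  triangle-zero {x} {y} {z} xy xz yz = begin
    x
      ≡⟨ solve 3 (λ x y z → x := con ½ :* ((x :+ y) :+ (x :+ z) :- (y :+ z))) refl x y z ⟩
    ½ *ℚ ((x +ℚ y) +ℚ (x +ℚ z) -ℚ (y +ℚ z))
      ≡⟨ cong (½ *ℚ_) (cong₂ _-ℚ_ (cong₂ _+ℚ_ xy xz) yz) ⟩
    0ℚ ∎
    where open ≡-Reasoning

+-cancelˡ-zero : ∀ {x y} → x +ℚ y ≡ 0ℚ → x ≡ 0ℚ → y ≡ 0ℚ
+-cancelˡ-zero {y = y} xy refl = trans (sym (+-identityˡ y)) xy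

module Walks {V : Set} (adj : V → V → Bool) where

  walk-head : ∀ {u v ws} → IsWalk adj u v ws → ∃ λ ws′ → ws ≡ u ∷ ws′
  walk-head walk-one = [] , refl
  walk-head (walk-cons _ _) = _ , refl

  walk-step : ∀ {u v ws} → IsWalk adj u v ws → u ≢ v →
    ∃₂ λ m ws′ → adj u m ≡ true × ws ≡ u ∷ m ∷ ws′
  walk-step walk-one u≢u = ⊥-elim (u≢u refl)
  walk-step (walk-cons a W) _ with walk-head W
  ... | ws′ , refl = _ , ws′ , a , refl

  walk-last : ∀ {u v ws} → IsWalk adj u v ws → v ∈ ws
  walk-last walk-one = here refl
  walk-last (walk-cons _ W) = there (walk-last W)

  walk-++ : ∀ {u v w xs ys} → IsWalk adj u v xs → IsWalk adj v w (v ∷ ys) → IsWalk adj u w (xs ++ ys)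
  walk-++ walk-one W = W
  walk-++ (walk-cons a W₁) W₂ = walk-cons a (walk-++ W₁ W₂)

  walk-split : ∀ {u v} xs {z ys} → IsWalk adj u v (xs ++ z ∷ ys) →
    IsWalk adj u z (xs ++ [ z ]) × IsWalk adj z v (z ∷ ys)
  walk-split [] walk-one = walk-one , walk-one
  walk-split [] (walk-cons a W) = walk-one , walk-cons a W
  walk-split (_ ∷ []) (walk-cons a W) = Product.map₁ (walk-cons a) (walk-split [] W)
  walk-split (_ ∷ x ∷ xs) (walk-cons a W) = Product.map₁ (walk-cons a) (walk-split (x ∷ xs) W)

  walk-adjacent : ∀ {u v} xs {s t ys} → IsWalk adj u v (xs ++ s ∷ t ∷ ys) → adj s t ≡ true
  walk-adjacent [] (walk-cons a walk-one) = a
  walk-adjacent [] (walk-cons a (walk-cons _ _)) = a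
  walk-adjacent (_ ∷ []) (walk-cons _ W) = walk-adjacent [] W
  walk-adjacent (_ ∷ x ∷ xs) (walk-cons _ W) = walk-adjacent (x ∷ xs) W

  walk-reverse : (∀ u v → adj u v ≡ adj v u) → ∀ {u v ws} → IsWalk adj u v ws → IsWalk adj v u (reverse ws)
  walk-reverse adj-sym walk-one = walk-one
  walk-reverse adj-sym {u} (walk-cons {w = w} {ws = ws} a W) =
    subst (IsWalk adj _ u) (sym (unfold-reverse u ws))
      (walk-++ (walk-reverse adj-sym W) (walk-cons (trans (adj-sym w u) a) walk-one))

  walk⇒path : DecidableEquality V → ∀ {u v ws} → IsWalk adj u v ws → ∃ λ ps → IsPath adj u v ps × ps ⊆ ws
  walk⇒path _≟_ walk-one = _ , (walk-one , [] ∷ []) , λ z∈ → z∈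
  walk⇒path _≟_ {u} (walk-cons a W) with walk⇒path _≟_ W
  ... | ps , (P , !ps) , ps⊆ws with member? _≟_ u ps
  ...   | no u∉ps = u ∷ ps , (walk-cons a P , ¬Any⇒All¬ ps u∉ps ∷ !ps) , ∷⁺ʳ u ps⊆ws
  ...   | yes u∈ps with ∈-∃++ u∈ps
  ...     | xs , ys , refl with walk-split xs P
  ...       | _ , P₂ =
    u ∷ ys , (P₂ , Unique-++⁻ʳ xs !ps) , ∷⁺ʳ u (λ z∈ys → ps⊆ws (∈-++⁺ʳ xs (there z∈ys)))

module OnList {n k : ℕ} where

  onList-sym : ∀ (s t : Vtx n k) L → onList s t L ≡ onList t s L
  onList-sym s t [] = refl
  onList-sym s t (u ∷ []) = refl
  onList-sym s t (u ∷ w ∷ ws) rewrite onList-sym s t (w ∷ ws) =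
    trans (sym (∨-assoc st ts _)) (trans (cong (_∨ onList t s (w ∷ ws)) (∨-comm st ts)) (∨-assoc ts st _))
    where
    st = ⌊ s ≟v u ⌋ ∧ ⌊ t ≟v w ⌋
    ts = ⌊ t ≟v u ⌋ ∧ ⌊ s ≟v w ⌋

  onList-∉ʳ : ∀ {s t : Vtx n k} L → t ∉ L → onList s t L ≡ false
  onList-∉ʳ [] _ = refl
  onList-∉ʳ (u ∷ []) _ = refl
  onList-∉ʳ {s} {t} (u ∷ w ∷ ws) t∉ = step (onList-∉ʳ (w ∷ ws) (t∉ ∘ there))
    where
    step : onList s t (w ∷ ws) ≡ false → onList s t (u ∷ w ∷ ws) ≡ false
    step rest with t ≟v u | t ≟v w
    ... | yes t≡u | _ = ⊥-elim (t∉ (here t≡u))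
    ... | no _ | yes t≡w = ⊥-elim (t∉ (there (here t≡w)))
    ... | no _ | no _ = trans (cong (_∨ onList s t (w ∷ ws)) (∧-zeroʳ ⌊ s ≟v u ⌋)) rest

  onList-∷ : ∀ {s t : Vtx n k} x L → onList s t L ≡ true → onList s t (x ∷ L) ≡ true
  onList-∷ {s} {t} x (w ∷ ws) eq rewrite eq = trans (cong (st ∨_) (∨-zeroʳ ts)) (∨-zeroʳ st)
    where
    st = ⌊ s ≟v x ⌋ ∧ ⌊ t ≟v w ⌋
    ts = ⌊ t ≟v x ⌋ ∧ ⌊ s ≟v w ⌋

  onList-++ : ∀ {s t : Vtx n k} xs ys → onList s t (xs ++ s ∷ t ∷ ys) ≡ true
  onList-++ {s} {t} [] ys with s ≟v s | t ≟v t
  ... | yes _ | yes _ = refl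
  ... | no s≢s | _ = ⊥-elim (s≢s refl)
  ... | yes _ | no t≢t = ⊥-elim (t≢t refl)
  onList-++ (x ∷ xs) ys = onList-∷ x (xs ++ _) (onList-++ xs ys)

module Paths {n : ℕ} (T : XTree n) where
  open XTree T using (k; adj; path; path-ok; path-unique; irrefl) renaming (sym to adj-sym)

  V : Set
  V = Vtx n k

  open Walks {V} adj

  path-walk : ∀ u v → IsWalk adj u v (path u v)
  path-walk u v = proj₁ (path-ok u v)

  path-Unique : ∀ u v → Unique (path u v)
  path-Unique u v = proj₂ (path-ok u v)

  ≡-path : ∀ {u v ps} → IsWalk adj u v ps → Unique ps → ps ≡ path u v
  ≡-path {u} {v} {ps} W !ps = path-unique u v ps (W , !ps)

  path-head : ∀ u v → ∃ λ ws → path u v ≡ u ∷ ws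
  path-head u v = walk-head (path-walk u v)

  ∈-path-start : ∀ u v → u ∈ path u v
  ∈-path-start u v with path-head u v
  ... | _ , eq = subst (u ∈_) (sym eq) (here refl)

  ∈-path-end : ∀ u v → v ∈ path u v
  ∈-path-end u v = walk-last (path-walk u v)

  path-self : ∀ u → path u u ≡ [ u ]
  path-self u = sym (≡-path walk-one ([] ∷ []))

  ∈-path-self : ∀ {u z} → z ∈ path u u → z ≡ u
  ∈-path-self {u} z∈ with subst (_ ∈_) (path-self u) z∈
  ... | here z≡u = z≡u

  adj⇒≢ : ∀ {u w} → adj u w ≡ true → u ≢ w
  adj⇒≢ {u} a refl with trans (sym a) (irrefl u)
  ... | ()

  path-adj : ∀ {u w} → adj u w ≡ true → path u w ≡ u ∷ w ∷ []
  path-adj a = sym (≡-path (walk-cons a walk-one) (((adj⇒≢ a) ∷ []) ∷ [] ∷ []))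

  path-sym : ∀ u v → path v u ≡ reverse (path u v)
  path-sym u v = sym (≡-path (walk-reverse adj-sym (path-walk u v)) (Unique-reverse (path-Unique u v)))

  ∈-path-sym : ∀ {u v z} → z ∈ path u v → z ∈ path v u
  ∈-path-sym {u} {v} z∈ = subst (_ ∈_) (sym (path-sym u v)) (∈-reverse⁺ z∈)

  path-split : ∀ {u v} xs {z ys} → path u v ≡ xs ++ z ∷ ys → path u z ≡ xs ++ [ z ] × path z v ≡ z ∷ ys
  path-split {u} {v} xs {z} {ys} eq with walk-split xs (subst (IsWalk adj u v) eq (path-walk u v))
  ... | W₁ , W₂ =
    sym (≡-path W₁ (Unique-++⁻ˡ (xs ++ [ z ]) !xs++[z]++ys)) , sym (≡-path W₂ (Unique-++⁻ʳ xs !xs++z∷ys))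
    where
    !xs++z∷ys : Unique (xs ++ z ∷ ys)
    !xs++z∷ys = subst Unique eq (path-Unique u v)
    !xs++[z]++ys : Unique ((xs ++ [ z ]) ++ ys)
    !xs++[z]++ys = subst Unique (sym (++-assoc xs [ z ] ys)) !xs++z∷ys

  path-prefix-⊆ : ∀ {u v z} → z ∈ path u v → path u z ⊆ path u v
  path-prefix-⊆ {u} {v} z∈ y∈ with ∈-∃++ z∈
  ... | xs , ys , eq with ∈-++⁻ xs (subst (_ ∈_) (proj₁ (path-split xs eq)) y∈)
  ...   | inj₁ y∈xs = subst (_ ∈_) (sym eq) (∈-++⁺ˡ y∈xs)
  ...   | inj₂ (here refl) = z∈

  path-via : ∀ s {a b z} → z ∈ path a b → z ∈ path s a ⊎ z ∈ path s b
  path-via s {a} {b} z∈ with path-head s b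
  ... | ws , eq
    with walk⇒path _≟v_ (walk-++ (walk-reverse adj-sym (path-walk s a)) (subst (IsWalk adj s b) eq (path-walk s b)))
  ...   | ps , (W , !ps) , ps⊆ with ∈-++⁻ (reverse (path s a)) (ps⊆ (subst (_ ∈_) (sym (≡-path W !ps)) z∈))
  ...     | inj₁ z∈rev = inj₁ (∈-reverse⁻ z∈rev)
  ...     | inj₂ z∈ws = inj₂ (subst (_ ∈_) (sym eq) (there z∈ws))

  path-convex : ∀ {p q a b} → a ∈ path p q → b ∈ path p q → path a b ⊆ path p q
  path-convex {p} a∈ b∈ z∈ with path-via p z∈
  ... | inj₁ z∈pa = path-prefix-⊆ a∈ z∈pa
  ... | inj₂ z∈pb = path-prefix-⊆ b∈ z∈pb

  Disjoint-path-symʳ : ∀ {a b c d} → Disjoint (path a b) (path c d) → Disjoint (path a b) (path d c)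
  Disjoint-path-symʳ ab∩cd≡∅ (v∈ab , v∈dc) = ab∩cd≡∅ (v∈ab , ∈-path-sym v∈dc)

  path-step : ∀ {s t z} → adj s t ≡ true → t ∈ path s z → path s z ≡ s ∷ path t z
  path-step {s} {t} {z} a t∈ with ∈-∃++ t∈
  ... | xs , ys , eq with path-split xs eq
  ...   | st≡xs++[t] , tz≡t∷ys with ∷ʳ-injectiveˡ xs [ s ] (trans (sym st≡xs++[t]) (path-adj a))
  ...     | refl = trans eq (cong (s ∷_) (sym tz≡t∷ys))

  path-extend : ∀ {s t z} → adj t s ≡ true → t ∉ path s z → path t z ≡ t ∷ path s z
  path-extend {s} {t} {z} a t∉ = sym (≡-path (walk-cons a (path-walk s z)) (¬Any⇒All¬ _ t∉ ∷ path-Unique s z))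

  ∈⇒∉-path-flip : ∀ {s t z} → adj s t ≡ true → t ∈ path s z → s ∉ path t z
  ∈⇒∉-path-flip {s} {t} {z} a t∈ with subst Unique (path-step a t∈) (path-Unique s z)
  ... | s∉ ∷ _ = All¬⇒¬Any s∉

  ∉⇒∈-path-flip : ∀ {s t z} → adj s t ≡ true → t ∉ path s z → s ∈ path t z
  ∉⇒∈-path-flip {s} {t} a t∉ =
    subst (s ∈_) (sym (path-extend (trans (adj-sym t s) a) t∉)) (there (∈-path-start s _))

  step-toward : ∀ {u z} → u ≢ z → ∃ λ m → adj u m ≡ true × m ∈ path u z
  step-toward {u} {z} u≢z with walk-step (path-walk u z) u≢z
  ... | m , _ , a , eq = m , a , subst (m ∈_) (sym eq) (there (here refl))

  step-unique : ∀ {u m m′ z} → adj u m ≡ true → adj u m′ ≡ true →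
    m ∈ path u z → m′ ∈ path u z → m ≡ m′
  step-unique {u} {m} {m′} {z} a a′ m∈ m′∈ with path-head m z | path-head m′ z
  ... | _ , eq | _ , eq′ with trans (sym (path-step a m∈)) (path-step a′ m′∈)
  ...   | u∷mz≡u∷m′z = ∷-injectiveˡ (trans (sym eq) (trans (∷-injectiveʳ u∷mz≡u∷m′z) eq′))

  step-∈-prefix : ∀ {u m a z} → adj u m ≡ true → m ∈ path u a → z ∈ path u a → z ≢ u → m ∈ path u z
  step-∈-prefix a m∈ z∈ z≢u with step-toward (λ u≡z → z≢u (sym u≡z))
  ... | m₀ , a₀ , m₀∈ with step-unique a a₀ m∈ (path-prefix-⊆ z∈ m₀∈)
  ...   | refl = m₀∈

  meet⇒∈-path : ∀ {u a b} → (∀ {z} → z ∈ path u a → z ∈ path u b → z ≡ u) → u ∈ path a b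
  meet⇒∈-path {u} {a} {b} meet with path-head u b
  ... | ys , eq with subst Unique eq (path-Unique u b)
  ...   | u∉ys ∷ !ys = subst (u ∈_) (≡-path walk (++⁺ (Unique-reverse (path-Unique u a)) !ys disjoint))
                                      (∈-++⁺ˡ (∈-reverse⁺ (∈-path-start u a)))
    where
    walk : IsWalk adj a b (reverse (path u a) ++ ys)
    walk = walk-++ (walk-reverse adj-sym (path-walk u a)) (subst (IsWalk adj u b) eq (path-walk u b))
    disjoint : Disjoint (reverse (path u a)) ys
    disjoint (z∈ua , z∈ys) with meet (∈-reverse⁻ z∈ua) (subst (_ ∈_) (sym eq) (there z∈ys))
    ... | refl = All¬⇒¬Any u∉ys z∈ys

  ∈-path⇒meet : ∀ {w x y z} → w ∈ path x y → z ∈ path w x → z ∈ path w y → z ≡ w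
  ∈-path⇒meet {w} {x} {y} w∈ z∈wx z∈wy with ∈-∃++ w∈
  ... | xs , ys , eq with path-split xs eq
  ...   | xw≡ , wy≡ with ∈-++⁻ xs (subst (_ ∈_) xw≡ (∈-path-sym z∈wx)) | subst (_ ∈_) wy≡ z∈wy
  ...     | inj₂ (here z≡w) | _ = z≡w
  ...     | inj₁ _ | here z≡w = z≡w
  ...     | inj₁ z∈xs | there z∈ys =
    ⊥-elim (Unique-++⇒Disjoint xs (subst Unique eq (path-Unique x y)) (z∈xs , there z∈ys))

  different-steps⇒∈-path : ∀ {u m₁ m₂ a b} → adj u m₁ ≡ true → adj u m₂ ≡ true → m₁ ≢ m₂ →
    m₁ ∈ path u a → m₂ ∈ path u b → u ∈ path a b
  different-steps⇒∈-path {u} a₁ a₂ m₁≢m₂ m₁∈ m₂∈ = meet⇒∈-path meet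
    where
    meet : ∀ {z} → z ∈ path u _ → z ∈ path u _ → z ≡ u
    meet {z} z∈a z∈b with z ≟v u
    ... | yes z≡u = z≡u
    ... | no z≢u =
      ⊥-elim (m₁≢m₂ (step-unique a₁ a₂ (step-∈-prefix a₁ m₁∈ z∈a z≢u) (step-∈-prefix a₂ m₂∈ z∈b z≢u)))

  ∈-path⇒different-steps : ∀ {u m₁ m₂ a b} → u ∈ path a b → adj u m₁ ≡ true →
    m₁ ∈ path u a → m₂ ∈ path u b → m₁ ≢ m₂
  ∈-path⇒different-steps u∈ a m₁∈ m₂∈ refl = adj⇒≢ a (sym (∈-path⇒meet u∈ m₁∈ m₂∈))

  edge-on-path : ∀ {s t x y} → adj s t ≡ true → t ∉ path s x → t ∈ path s y →
    ∃₂ λ xs ys → path x y ≡ xs ++ s ∷ t ∷ ys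
  edge-on-path {s} {t} {x} {y} a t∉x t∈y with ∈-∃++ s∈xy
    where
    s∈xy : s ∈ path x y
    s∈xy with s ≟v x
    ... | yes refl = ∈-path-start s y
    ... | no s≢x with step-toward s≢x
    ...   | m , aₘ , m∈ = different-steps⇒∈-path aₘ a (λ { refl → t∉x m∈ }) m∈ t∈y
  ... | xs , ys , eq with path-split xs eq | path-head t y
  ...   | _ , sy≡s∷ys | ws , ty≡t∷ws = xs , ws , trans eq (cong (λ L → xs ++ s ∷ L) ys≡t∷ws)
    where
    ys≡t∷ws : ys ≡ t ∷ ws
    ys≡t∷ws = trans (∷-injectiveʳ (trans (sym sy≡s∷ys) (path-step a t∈y))) ty≡t∷ws

  median : ∀ x y z → ∃ λ m → m ∈ path x y × m ∈ path y z × m ∈ path x z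
  median x y z with first-common _≟v_ (path z x) (path x y) (∈-path-end z x) (∈-path-start x y)
  ... | pre , m , post , eq , pre∉xy , m∈xy = m , m∈xy , meet⇒∈-path meet , ∈-path-sym m∈zx
    where
    m∈zx : m ∈ path z x
    m∈zx = subst (m ∈_) (sym eq) (∈-++⁺ʳ pre (here refl))
    meet : ∀ {v} → v ∈ path m y → v ∈ path m z → v ≡ m
    meet v∈my v∈mz with ∈-++⁻ pre (subst (_ ∈_) (proj₁ (path-split pre eq)) (∈-path-sym v∈mz))
    ... | inj₂ (here v≡m) = v≡m
    ... | inj₁ v∈pre = ⊥-elim (All.lookup pre∉xy v∈pre (path-convex m∈xy (∈-path-end x y) v∈my))

  avoiding-path-in-branch : ∀ {m p q} → m ∉ path p q →
    ∃ λ c → adj m c ≡ true × (∀ {w} → w ∈ path p q → c ∈ path m w)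
  avoiding-path-in-branch {m} {p} {q} m∉pq
    with step-toward {m} {p} (λ { refl → m∉pq (∈-path-start m q) })
       | step-toward {m} {q} (λ { refl → m∉pq (∈-path-end p m) })
  ... | cₚ , aₚ , cₚ∈ | c_q , a_q , c_q∈ with cₚ ≟v c_q
  ...   | no cₚ≢c_q = ⊥-elim (m∉pq (different-steps⇒∈-path aₚ a_q cₚ≢c_q cₚ∈ c_q∈))
  ...   | yes refl = cₚ , aₚ , toward
    where
    toward : ∀ {w} → w ∈ path p q → cₚ ∈ path m w
    toward {w} w∈ with w ≟v m
    ... | yes refl = ⊥-elim (m∉pq w∈)
    ... | no w≢m with path-via m w∈
    ...   | inj₁ w∈mp = step-∈-prefix aₚ cₚ∈ w∈mp w≢m
    ...   | inj₂ w∈mq = step-∈-prefix aₚ c_q∈ w∈mq w≢m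

  branch-disjoint : ∀ {m c c₁ c₂ a b ws} → adj m c ≡ true → (∀ {w} → w ∈ ws → c ∈ path m w) →
    adj m c₁ ≡ true → c₁ ∈ path m a → adj m c₂ ≡ true → c₂ ∈ path m b → c₁ ≢ c → c₂ ≢ c →
    Disjoint ws (path a b)
  branch-disjoint {m} a in-c a₁ c₁∈ a₂ c₂∈ c₁≢c c₂≢c {w} (w∈ws , w∈ab) with w ≟v m
  ... | yes refl = adj⇒≢ a (sym (∈-path-self (in-c w∈ws)))
  ... | no w≢m with path-via m w∈ab
  ...   | inj₁ w∈ma = c₁≢c (step-unique a₁ a (step-∈-prefix a₁ c₁∈ w∈ma w≢m) (in-c w∈ws))
  ...   | inj₂ w∈mb = c₂≢c (step-unique a₂ a (step-∈-prefix a₂ c₂∈ w∈mb w≢m) (in-c w∈ws))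

  ∈-path-of-median : ∀ {m x y z} → m ∈ path x y → m ∈ path y z → m ∈ path x z →
    m ≢ x → m ≢ y → m ≢ z → ∀ p q →
    ¬ Disjoint (path p q) (path x y) → ¬ Disjoint (path p q) (path y z) → ¬ Disjoint (path p q) (path x z) →
    m ∈ path p q
  ∈-path-of-median {m} m∈xy m∈yz m∈xz m≢x m≢y m≢z p q meets-xy meets-yz meets-xz with member? _≟v_ m (path p q)
  ... | yes m∈pq = m∈pq
  ... | no m∉pq with avoiding-path-in-branch m∉pq | step-toward m≢x | step-toward m≢y | step-toward m≢z
  ...   | c , a , in-c | n₁ , a₁ , n₁∈ | n₂ , a₂ , n₂∈ | n₃ , a₃ , n₃∈ with n₁ ≟v c | n₂ ≟v c
  ...     | yes refl | _ = ⊥-elim (meets-yz (branch-disjoint a in-c a₂ n₂∈ a₃ n₃∈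
                              (≢-sym (∈-path⇒different-steps m∈xy a₁ n₁∈ n₂∈))
                              (≢-sym (∈-path⇒different-steps m∈xz a₁ n₁∈ n₃∈))))
  ...     | no n₁≢c | yes refl = ⊥-elim (meets-xz (branch-disjoint a in-c a₁ n₁∈ a₃ n₃∈
                                   n₁≢c (≢-sym (∈-path⇒different-steps m∈yz a₂ n₂∈ n₃∈))))
  ...     | no n₁≢c | no n₂≢c = ⊥-elim (meets-xy (branch-disjoint a in-c a₁ n₁∈ a₂ n₂∈ n₁≢c n₂≢c))

module Leaves {n : ℕ} (T : XTree n) where
  open XTree T using (k; adj; path; leaf-deg; deg1-leaf; no-deg2) renaming (sym to adj-sym)
  open Paths T

  ∈-allVtx : ∀ v → v ∈ allVtx n k
  ∈-allVtx (inj₁ x) = ∈-++⁺ˡ (∈-map⁺ inj₁ (∈-allFin x))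
  ∈-allVtx (inj₂ i) = ∈-++⁺ʳ (map inj₁ (allFin n)) (∈-map⁺ inj₂ (∈-allFin i))

  allVtx-Unique : Unique (allVtx n k)
  allVtx-Unique = ++⁺ (map⁺ inj₁-injective (allFin⁺ n)) (map⁺ inj₂-injective (allFin⁺ k)) leaves∩interior
    where
    leaves∩interior : Disjoint (map inj₁ (allFin n)) (map inj₂ (allFin k))
    leaves∩interior (v∈₁ , v∈₂) with ∈-map⁻ inj₁ v∈₁ | ∈-map⁻ inj₂ v∈₂
    ... | _ , _ , refl | _ , _ , ()

  neighbours : V → List V
  neighbours v = filter (λ w → adj v w ≟ᵇ true) (allVtx n k)

  deg≡length-neighbours : ∀ v → deg adj v ≡ length (neighbours v)
  deg≡length-neighbours v = ones≡length-filter (adj v) (allVtx n k)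

  ∈-neighbours : ∀ {v w} → adj v w ≡ true → w ∈ neighbours v
  ∈-neighbours {w = w} a = ∈-filter⁺ (λ w → adj _ w ≟ᵇ true) (∈-allVtx w) a

  neighbours⊆⇒deg≤ : ∀ {v ws} → neighbours v ⊆ ws → deg adj v ≤ length ws
  neighbours⊆⇒deg≤ {v} ⊆ws = subst (_≤ _) (sym (deg≡length-neighbours v))
    (Unique-⊆⇒length≤ (filter⁺ (λ w → adj v w ≟ᵇ true) allVtx-Unique) ⊆ws)

  ⊆neighbours⇒≤deg : ∀ {v ws} → Unique ws → (∀ {w} → w ∈ ws → adj v w ≡ true) → length ws ≤ deg adj v
  ⊆neighbours⇒≤deg {v} !ws adjacent = subst (_ ≤_) (sym (deg≡length-neighbours v))
    (Unique-⊆⇒length≤ !ws (λ w∈ → ∈-neighbours (adjacent w∈)))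

  leaf-neighbour-unique : ∀ {x a b} → adj (inj₁ x) a ≡ true → adj (inj₁ x) b ≡ true → a ≡ b
  leaf-neighbour-unique {x} {a} {b} aₐ a_b with a ≟v b
  ... | yes a≡b = a≡b
  ... | no a≢b with subst (2 ≤_) (leaf-deg x) (⊆neighbours⇒≤deg ((a≢b ∷ []) ∷ [] ∷ []) adjacent)
    where
    adjacent : ∀ {w} → w ∈ a ∷ b ∷ [] → adj (inj₁ x) w ≡ true
    adjacent (here refl) = aₐ
    adjacent (there (here refl)) = a_b
  ...   | s≤s ()

  interior-neighbour-avoiding : ∀ {i m} → adj (inj₂ i) m ≡ true → ∀ a b →
    ∃ λ c → adj (inj₂ i) c ≡ true × c ≢ a × c ≢ b
  interior-neighbour-avoiding {i} {m} aₘ a b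
    with any? (λ c → ¬? (c ≟v a) ×-dec ¬? (c ≟v b)) (neighbours (inj₂ i))
  ... | yes found with find found
  ...   | c , c∈ , avoids = c , proj₂ (∈-filter⁻ (λ w → adj (inj₂ i) w ≟ᵇ true) {xs = allVtx n k} c∈) , avoids
  interior-neighbour-avoiding {i} {m} aₘ a b | no none =
    ⊥-elim (deg-1-or-2 (deg adj (inj₂ i)) refl
      (⊆neighbours⇒≤deg ([] ∷ []) λ { (here refl) → aₘ }) (neighbours⊆⇒deg≤ ⊆ab))
    where
    ⊆ab : neighbours (inj₂ i) ⊆ a ∷ b ∷ []
    ⊆ab {w} w∈ with w ≟v a | w ≟v b
    ... | yes w≡a | _ = here w≡a
    ... | no _ | yes w≡b = there (here w≡b)
    ... | no w≢a | no w≢b = ⊥-elim (none (lose w∈ (w≢a , w≢b)))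
    deg-1-or-2 : ∀ d → d ≡ deg adj (inj₂ i) → 1 ≤ d → d ≤ 2 → ⊥
    deg-1-or-2 1 d≡ _ _ with deg1-leaf (inj₂ i) (sym d≡)
    ... | _ , ()
    deg-1-or-2 2 d≡ _ _ = no-deg2 (inj₂ i) (sym d≡)
    deg-1-or-2 (suc (suc (suc _))) _ _ (s≤s (s≤s ()))

  leaf-∈-path : ∀ {x p q} → inj₁ x ∈ path p q → inj₁ x ≡ p ⊎ inj₁ x ≡ q
  leaf-∈-path {x} {p} {q} x∈ with inj₁ x ≟v p | inj₁ x ≟v q
  ... | yes x≡p | _ = inj₁ x≡p
  ... | no _ | yes x≡q = inj₂ x≡q
  ... | no x≢p | no x≢q with step-toward x≢p | step-toward x≢q
  ...   | mₚ , aₚ , mₚ∈ | m_q , a_q , m_q∈ with leaf-neighbour-unique aₚ a_q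
  ...     | refl = ⊥-elim (∈-path⇒different-steps x∈ aₚ mₚ∈ m_q∈ refl)

  branch-leaf : ∀ {u m} → adj u m ≡ true → ∃ λ x → m ∈ path u (inj₁ x)
  branch-leaf {u} {m} aₘ with path-head m u
  ... | ws , mu≡m∷ws = Product.map₂ ∈-path-sym
        (extend N m (≢-sym (adj⇒≢ aₘ)) (∈-path-start m u)
                (m<n+m N (subst (λ L → 0 < length L) (sym mu≡m∷ws) z<s)))
    where
    N : ℕ
    N = length (allVtx n k)
    extend : ∀ fuel z → z ≢ u → m ∈ path z u → N < length (path z u) + fuel → ∃ λ x → m ∈ path (inj₁ x) u
    extend zero z _ _ overflow = ⊥-elim (<⇒≱ (subst (N <_) (+-identityʳ _) overflow)
      (Unique-⊆⇒length≤ (path-Unique z u) (λ {v} _ → ∈-allVtx v)))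
    extend (suc fuel) (inj₁ x) _ m∈ _ = x , m∈
    extend (suc fuel) (inj₂ i) z≢u m∈ overflow with step-toward z≢u
    ... | p , aₚ , p∈ with interior-neighbour-avoiding aₚ p p
    ...   | c , a_c , c≢p , _ = extend fuel c c≢u (subst (m ∈_) (sym cu≡) (there m∈)) (subst (N <_) longer overflow)
      where
      c∉ : c ∉ path (inj₂ i) u
      c∉ c∈ = c≢p (step-unique a_c aₚ c∈ p∈)
      cu≡ : path c u ≡ c ∷ path (inj₂ i) u
      cu≡ = path-extend (trans (adj-sym c (inj₂ i)) a_c) c∉
      c≢u : c ≢ u
      c≢u refl = c∉ (∈-path-end _ _)
      longer : length (path (inj₂ i) u) + suc fuel ≡ length (path c u) + fuel
      longer = trans (+-suc _ fuel) (cong (λ L → length L + fuel) (sym cu≡))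

  interior-median : Fin n → ∀ i → ∃₂ λ x y → ∃ λ z →
    inj₂ i ∈ path (inj₁ x) (inj₁ y) × inj₂ i ∈ path (inj₁ y) (inj₁ z) × inj₂ i ∈ path (inj₁ x) (inj₁ z)
  interior-median x₀ i with step-toward {inj₂ i} {inj₁ x₀} (λ ())
  ... | n₁ , a₁ , _ with interior-neighbour-avoiding a₁ n₁ n₁
  ...   | n₂ , a₂ , n₂≢n₁ , _ with interior-neighbour-avoiding a₁ n₁ n₂
  ...     | n₃ , a₃ , n₃≢n₁ , n₃≢n₂ with branch-leaf a₁ | branch-leaf a₂ | branch-leaf a₃
  ...       | x , n₁∈ | y , n₂∈ | z , n₃∈ =
    x , y , z , different-steps⇒∈-path a₁ a₂ (≢-sym n₂≢n₁) n₁∈ n₂∈ ,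
                different-steps⇒∈-path a₂ a₃ (≢-sym n₃≢n₂) n₂∈ n₃∈ ,
                different-steps⇒∈-path a₁ a₃ (≢-sym n₃≢n₁) n₁∈ n₃∈

  Between : V → Fin n → Fin n → Set
  Between v p q = v ∈ path (inj₁ p) (inj₁ q)

  Between-leaf : ∀ {x p q} → Between (inj₁ x) p q → x ≡ p ⊎ x ≡ q
  Between-leaf = Sum.map inj₁-injective inj₁-injective ∘ leaf-∈-path

  leaf-path-self-disjoint : ∀ {p x y} → p ≢ x → p ≢ y →
    Disjoint (path (inj₁ p) (inj₁ p)) (path (inj₁ x) (inj₁ y))
  leaf-path-self-disjoint p≢x p≢y (v∈pp , v∈xy) with ∈-path-self v∈pp
  ... | refl = [ p≢x , p≢y ]′ (Between-leaf v∈xy)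

  Between-injective : ∀ {u v} → (∀ p q → Between u p q → Between v p q) →
    (∀ p q → Between v p q → Between u p q) → u ≡ v
  Between-injective {inj₁ x} u⊆v _ = sym (∈-path-self (u⊆v x x (∈-path-start _ _)))
  Between-injective {inj₂ i} {inj₁ y} _ v⊆u = ∈-path-self (v⊆u y y (∈-path-start _ _))
  Between-injective {inj₂ i} {inj₂ j} u⊆v _ with inj₂ i ≟v inj₂ j
  ... | yes i≡j = i≡j
  ... | no i≢j with step-toward i≢j
  ...   | m , aₘ , m∈ with interior-neighbour-avoiding aₘ m m
  ...     | c₁ , a₁ , c₁≢m , _ with interior-neighbour-avoiding aₘ m c₁
  ...       | c₂ , a₂ , c₂≢m , c₂≢c₁ with branch-leaf a₁ | branch-leaf a₂
  ...         | p , c₁∈ | q , c₂∈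
    with path-via (inj₂ i) (u⊆v p q (different-steps⇒∈-path a₁ a₂ (≢-sym c₂≢c₁) c₁∈ c₂∈))
  ... | inj₁ j∈ip = ⊥-elim (c₁≢m (step-unique a₁ aₘ (step-∈-prefix a₁ c₁∈ j∈ip (≢-sym i≢j)) m∈))
  ... | inj₂ j∈iq = ⊥-elim (c₂≢m (step-unique a₂ aₘ (step-∈-prefix a₂ c₂∈ j∈iq (≢-sym i≢j)) m∈))

  private
    separable-from-far-side : ∀ {u v w} → adj u v ≡ true → w ≢ u → v ∉ path u w →
      ∃₂ λ p q → Between u p q × Between v p q × ¬ Between w p q
    separable-from-far-side {inj₁ x} {v} {w} a w≢u v∉ with branch-leaf a
    ... | q , v∈ = x , q , ∈-path-start _ _ , v∈ , λ w∈ → v∉ (step-∈-prefix a v∈ w∈ w≢u)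
    separable-from-far-side {inj₂ i} {v} {w} a w≢u v∉ with branch-leaf a | step-toward (≢-sym w≢u)
    ... | q , v∈ | m , aₘ , m∈ with interior-neighbour-avoiding a v m
    ...   | c , a_c , c≢v , c≢m with branch-leaf a_c
    ...     | p , c∈ = p , q , i∈pq , path-convex i∈pq (∈-path-end _ _) v∈ , w∉
      where
      i∈pq : inj₂ i ∈ path (inj₁ p) (inj₁ q)
      i∈pq = different-steps⇒∈-path a_c a c≢v c∈ v∈
      w∉ : ¬ Between w p q
      w∉ w∈ with path-via (inj₂ i) w∈
      ... | inj₁ w∈ip = c≢m (step-unique a_c aₘ (step-∈-prefix a_c c∈ w∈ip w≢u) m∈)
      ... | inj₂ w∈iq = v∉ (step-∈-prefix a v∈ w∈iq w≢u)

  edge-separable : ∀ {u v w} → adj u v ≡ true → w ≢ u → w ≢ v →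
    ∃₂ λ p q → Between u p q × Between v p q × ¬ Between w p q
  edge-separable {u} {v} {w} a w≢u w≢v with member? _≟v_ v (path u w)
  ... | no v∉ = separable-from-far-side a w≢u v∉
  ... | yes v∈ with separable-from-far-side (trans (adj-sym v u) a) w≢v (∈⇒∉-path-flip a v∈)
  ...   | p , q , v∈pq , u∈pq , w∉pq = p , q , u∈pq , v∈pq , w∉pq

module Sides {n : ℕ} (T : XTree n) where
  open XTree T using (k; adj; path) renaming (sym to adj-sym)
  open Paths T
  open Leaves T using (leaf-neighbour-unique)
  open Walks adj using (walk-adjacent)
  open OnList {n} {k}

  side : V → V → V → Bool
  side s t z = does (member? _≟v_ t (path s z))

  side-∈ : ∀ {s t z} → t ∈ path s z → side s t z ≡ true
  side-∈ {s} {t} {z} = dec-true (member? _≟v_ t (path s z))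

  side-∉ : ∀ {s t z} → t ∉ path s z → side s t z ≡ false
  side-∉ {s} {t} {z} = dec-false (member? _≟v_ t (path s z))

  ∉-path-convex : ∀ s {t x y z} → t ∉ path s x → t ∉ path s y → z ∈ path x y → t ∉ path s z
  ∉-path-convex s t∉x t∉y z∈ t∈z with path-via s z∈
  ... | inj₁ z∈sx = t∉x (path-prefix-⊆ z∈sx t∈z)
  ... | inj₂ z∈sy = t∉y (path-prefix-⊆ z∈sy t∈z)

  onList-path : ∀ {s t} → adj s t ≡ true → ∀ x y → onList s t (path x y) ≡ side s t x xor side s t y
  onList-path {s} {t} a x y with member? _≟v_ t (path s x) | member? _≟v_ t (path s y)
  ... | no t∉x | no t∉y = onList-∉ʳ (path x y) (λ t∈xy → ∉-path-convex s t∉x t∉y t∈xy (∈-path-end s t))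
  ... | yes t∈x | yes t∈y = trans (onList-sym s t (path x y)) (onList-∉ʳ (path x y) s∉xy)
    where
    s∉xy : s ∉ path x y
    s∉xy s∈xy = ∉-path-convex t (∈⇒∉-path-flip a t∈x) (∈⇒∉-path-flip a t∈y) s∈xy (∈-path-end t s)
  ... | no t∉x | yes t∈y with edge-on-path a t∉x t∈y
  ...   | xs , ys , eq = subst (λ L → onList s t L ≡ true) (sym eq) (onList-++ xs ys)
  onList-path {s} {t} a x y | yes t∈x | no t∉y
    with edge-on-path (trans (adj-sym t s) a) (∈⇒∉-path-flip a t∈x) (∉⇒∈-path-flip a t∉y)
  ... | xs , ys , eq = trans (onList-sym s t (path x y)) (subst (λ L → onList t s L ≡ true) (sym eq) (onList-++ xs ys))

  side-convex : ∀ {s t x y z} → adj s t ≡ true → side s t x ≡ side s t y → z ∈ path x y →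
    side s t z ≡ side s t x
  side-convex {s} {t} {x} {y} {z} a same z∈
    with member? _≟v_ t (path s x) | member? _≟v_ t (path s y) | member? _≟v_ t (path s z)
  ... | yes _ | yes _ | yes _ = refl
  ... | no _ | no _ | no _ = refl
  ... | yes t∈x | yes t∈y | no t∉z =
    ⊥-elim (t∉z (∉⇒∈-path-flip (trans (adj-sym t s) a)
                  (∉-path-convex t (∈⇒∉-path-flip a t∈x) (∈⇒∉-path-flip a t∈y) z∈)))
  ... | no t∉x | no t∉y | yes t∈z = ⊥-elim (∉-path-convex s t∉x t∉y z∈ t∈z)
  ... | yes _ | no _ | _ with () ← same
  ... | no _ | yes _ | _ with () ← same

  separating-edge : ∀ {a b c d} → Disjoint (path a b) (path c d) →
    ∃₂ λ s t → adj s t ≡ true × t ∉ path s a × t ∉ path s b × t ∈ path s c × t ∈ path s d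
  separating-edge {a} {b} {c} {d} disjoint
    with first-common _≟v_ (path a c) (path c d) (∈-path-end a c) (∈-path-start c d)
  ... | pre , t , post , eq , pre∉cd , t∈cd with initLast pre
  ...   | [] with path-head a c
  ...     | _ , ac≡a∷ with trans (sym eq) ac≡a∷
  ...       | refl = ⊥-elim (disjoint (∈-path-start a b , t∈cd))
  separating-edge {a} {b} {c} {d} disjoint | pre , t , post , eq , pre∉cd , t∈cd | pre′ ∷ʳ′ s =
    s , t , aₛₜ , t∉sa , t∉sb , toward-cd (∈-path-start c d) , toward-cd (∈-path-end c d)
    where
    eq′ : path a c ≡ pre′ ++ s ∷ t ∷ post
    eq′ = trans eq (++-assoc pre′ [ s ] (t ∷ post))
    aₛₜ : adj s t ≡ true
    aₛₜ = walk-adjacent pre′ (subst (IsWalk adj a c) eq′ (path-walk a c))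
    s∉cd : s ∉ path c d
    s∉cd = All.lookup pre∉cd (∈-++⁺ʳ pre′ (here refl))
    toward-cd : ∀ {z} → z ∈ path c d → t ∈ path s z
    toward-cd {z} z∈ with member? _≟v_ t (path s z)
    ... | yes t∈sz = t∈sz
    ... | no t∉sz = ⊥-elim (s∉cd (path-convex t∈cd z∈ (∉⇒∈-path-flip aₛₜ t∉sz)))
    t∉sa : t ∉ path s a
    t∉sa t∈sa with ∈-++⁻ pre′ (subst (t ∈_) (proj₁ (path-split pre′ eq′)) (∈-path-sym t∈sa))
    ... | inj₁ t∈pre′ = All.lookup pre∉cd (∈-++⁺ˡ t∈pre′) t∈cd
    ... | inj₂ (here t≡s) = adj⇒≢ aₛₜ (sym t≡s)
    t∉sb : t ∉ path s b
    t∉sb t∈sb with edge-on-path aₛₜ t∉sa t∈sb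
    ... | xs , ys , ab≡ = disjoint (subst (t ∈_) (sym ab≡) (∈-++⁺ʳ xs (there (here refl))) , t∈cd)

  pendant-edge : ∀ {a b : Fin n} → a ≢ b →
    ∃₂ λ s t → adj s t ≡ true × t ∉ path s (inj₁ a) × (∀ {x} → x ≢ a → t ∈ path s (inj₁ x))
  pendant-edge {a} a≢b with step-toward {inj₁ a} {inj₁ _} (a≢b ∘ inj₁-injective)
  ... | t , aₜ , _ = inj₁ a , t , aₜ , (λ t∈ → adj⇒≢ aₜ (sym (∈-path-self t∈))) , toward
    where
    toward : ∀ {x} → x ≢ a → t ∈ path (inj₁ a) (inj₁ x)
    toward x≢a with step-toward {inj₁ a} {inj₁ _} (x≢a ∘ sym ∘ inj₁-injective)
    ... | t′ , aₜ′ , t′∈ with leaf-neighbour-unique aₜ aₜ′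
    ...   | refl = t′∈

  disjoint-pairing-unique : ∀ {a b c d} → Disjoint (path a b) (path c d) → ¬ Disjoint (path a c) (path b d)
  disjoint-pairing-unique ab∩cd≡∅ ac∩bd≡∅ with separating-edge ab∩cd≡∅
  ... | s , t , aₛₜ , t∉a , t∉b , t∈c , t∈d with edge-on-path aₛₜ t∉a t∈c | edge-on-path aₛₜ t∉b t∈d
  ...   | xs , _ , ac≡ | ys , _ , bd≡ =
    ac∩bd≡∅ (subst (t ∈_) (sym ac≡) (∈-++⁺ʳ xs (there (here refl))) ,
             subst (t ∈_) (sym bd≡) (∈-++⁺ʳ ys (there (here refl))))

module Cords {n : ℕ} where

  cord : (x y : Fin n) → x ≢ y → Cord n
  cord x y x≢y with <-cmp x y
  ... | tri< x<y _ _ = (x , y) , x<y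
  ... | tri≈ _ x≡y _ = ⊥-elim (x≢y x≡y)
  ... | tri> _ _ y<x = (y , x) , y<x

  Endpoint : Fin n → Cord n → Set
  Endpoint z ((x , y) , _) = z ≡ x ⊎ z ≡ y

  Endpoint-cord⁺ : ∀ {z x y} (x≢y : x ≢ y) → z ≡ x ⊎ z ≡ y → Endpoint z (cord x y x≢y)
  Endpoint-cord⁺ {x = x} {y} x≢y z∈ with <-cmp x y
  ... | tri< _ _ _ = z∈
  ... | tri≈ _ x≡y _ = ⊥-elim (x≢y x≡y)
  ... | tri> _ _ _ = Sum.swap z∈

  Endpoint-cord⁻ : ∀ {z x y} (x≢y : x ≢ y) → Endpoint z (cord x y x≢y) → z ≡ x ⊎ z ≡ y
  Endpoint-cord⁻ {x = x} {y} x≢y z∈ with <-cmp x y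
  ... | tri< _ _ _ = z∈
  ... | tri≈ _ x≡y _ = ⊥-elim (x≢y x≡y)
  ... | tri> _ _ _ = Sum.swap z∈

  cord-≢ : ∀ {z x y x′ y′} {x≢y : x ≢ y} {x′≢y′ : x′ ≢ y′} → z ≢ x → z ≢ y → z ≡ x′ ⊎ z ≡ y′ →
    cord x y x≢y ≢ cord x′ y′ x′≢y′
  cord-≢ {x≢y = x≢y} {x′≢y′} z≢x z≢y z∈′ eq =
    [ z≢x , z≢y ]′ (Endpoint-cord⁻ x≢y (subst (Endpoint _) (sym eq) (Endpoint-cord⁺ x′≢y′ z∈′)))

  weight : (Fin n → ℚ) → Cord n → ℚ
  weight ε ((x , y) , _) = ε x *ℚ ε y

  weight-cord : ∀ ε x y (x≢y : x ≢ y) → weight ε (cord x y x≢y) ≡ ε x *ℚ ε y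
  weight-cord ε x y x≢y with <-cmp x y
  ... | tri< _ _ _ = refl
  ... | tri≈ _ x≡y _ = ⊥-elim (x≢y x≡y)
  ... | tri> _ _ _ = *-comm (ε y) (ε x)

  record Distinct₄ (a b c d : Fin n) : Set where
    field
      a≢b : a ≢ b
      a≢c : a ≢ c
      a≢d : a ≢ d
      b≢c : b ≢ c
      b≢d : b ≢ d
      c≢d : c ≢ d

  crossCords : ∀ {a b c d} → Distinct₄ a b c d → List (Cord n)
  crossCords {a} {b} {c} {d} D = cord a c a≢c ∷ cord a d a≢d ∷ cord b c b≢c ∷ cord b d b≢d ∷ []
    where open Distinct₄ D

  crossCords-Unique : ∀ {a b c d} (D : Distinct₄ a b c d) → Unique (crossCords D)
  crossCords-Unique {a} {b} D =
      (cord-≢ {x′ = a} (≢-sym a≢d) (≢-sym c≢d) (inj₂ refl) ∷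
       cord-≢ (≢-sym a≢b) b≢c (inj₁ refl) ∷ cord-≢ (≢-sym a≢b) b≢c (inj₁ refl) ∷ [])
    ∷ (cord-≢ (≢-sym a≢b) b≢d (inj₁ refl) ∷ cord-≢ (≢-sym a≢b) b≢d (inj₁ refl) ∷ [])
    ∷ (cord-≢ {x′ = b} (≢-sym b≢d) (≢-sym c≢d) (inj₂ refl) ∷ [])
    ∷ [] ∷ []
    where open Distinct₄ D

χ : Bool → ℚ
χ b = if b then 1ℚ else 0ℚ

crossForm : ℚ → ℚ → ℚ → ℚ → Bool → Bool → Bool → Bool → ℚ
crossForm α β γ δ sa sb sc sd =
  α *ℚ χ (sa xor sc) +ℚ (β *ℚ χ (sa xor sd) +ℚ (γ *ℚ χ (sb xor sc) +ℚ (δ *ℚ χ (sb xor sd) +ℚ 0ℚ)))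

module _ where
  open +-*-Solver

  private
    form : ∀ {m} → (α β γ δ p q r s : Polynomial m) → Polynomial m
    form α β γ δ p q r s = α :* p :+ (β :* q :+ (γ :* r :+ (δ :* s :+ con 0ℚ)))
    𝟙 𝟘 -𝟙 : ∀ {m} → Polynomial m
    𝟙 = con 1ℚ
    𝟘 = con 0ℚ
    -𝟙 = con (-ℚ 1ℚ)

  crossForm-FTTT : ∀ α β γ δ → crossForm α β γ δ false true true true ≡ α +ℚ β
  crossForm-FTTT = solve 4 (λ α β γ δ → form α β γ δ 𝟙 𝟙 𝟘 𝟘 := α :+ β) refl

  crossForm-TFTT : ∀ α β γ δ → crossForm α β γ δ true false true true ≡ γ +ℚ δ
  crossForm-TFTT = solve 4 (λ α β γ δ → form α β γ δ 𝟘 𝟘 𝟙 𝟙 := γ :+ δ) refl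

  crossForm-TTFT : ∀ α β γ δ → crossForm α β γ δ true true false true ≡ α +ℚ γ
  crossForm-TTFT = solve 4 (λ α β γ δ → form α β γ δ 𝟙 𝟘 𝟙 𝟘 := α :+ γ) refl

  crossForm-FTFT : ∀ α β γ δ → crossForm α β γ δ false true false true ≡ β +ℚ γ
  crossForm-FTFT = solve 4 (λ α β γ δ → form α β γ δ 𝟘 𝟙 𝟙 𝟘 := β :+ γ) refl

  crossForm-balanced : ∀ {sa sb sc sd} → sa ≡ sb ⊎ sc ≡ sd →
    crossForm 1ℚ (-ℚ 1ℚ) (-ℚ 1ℚ) 1ℚ sa sb sc sd ≡ 0ℚ
  crossForm-balanced {sa} {_} {sc} {sd} (inj₁ refl) =
    solve 2 (λ p q → form 𝟙 -𝟙 -𝟙 𝟙 p q p q := 𝟘) refl (χ (sa xor sc)) (χ (sa xor sd))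
  crossForm-balanced {sa} {sb} {sc} (inj₂ refl) =
    solve 2 (λ p q → form 𝟙 -𝟙 -𝟙 𝟙 p p q q := 𝟘) refl (χ (sa xor sc)) (χ (sb xor sc))

LinearRelation : ∀ {n} → XTree n → (Cord n → ℚ) → List (Cord n) → Set
LinearRelation T κ I = ∀ s t → XTree.adj T s t ≡ true → sumℚ (map (λ xy → κ xy *ℚ lam T xy s t) I) ≡ 0ℚ

module Quartets {n : ℕ} (T : XTree n) where
  open XTree T using (k; adj; path)
  open Paths T
  open Sides T
  open Cords

  lam-cord : ∀ {s t} → adj s t ≡ true → ∀ x y (x≢y : x ≢ y) →
    lam T (cord x y x≢y) s t ≡ χ (side s t (inj₁ x) xor side s t (inj₁ y))
  lam-cord {s} {t} aₛₜ x y x≢y with <-cmp x y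
  ... | tri< _ _ _ = cong χ (onList-path aₛₜ (inj₁ x) (inj₁ y))
  ... | tri≈ _ x≡y _ = ⊥-elim (x≢y x≡y)
  ... | tri> _ _ _ = cong χ (trans (onList-path aₛₜ (inj₁ y) (inj₁ x)) (xor-comm (side s t (inj₁ y)) _))

  module _ {a b c d : Fin n} (D : Distinct₄ a b c d) where
    open Distinct₄ D

    crossCords-on-edge : ∀ (κ : Cord n → ℚ) {s t} → adj s t ≡ true →
      sumℚ (map (λ xy → κ xy *ℚ lam T xy s t) (crossCords D)) ≡
      crossForm (κ (cord a c a≢c)) (κ (cord a d a≢d)) (κ (cord b c b≢c)) (κ (cord b d b≢d))
                (side s t (inj₁ a)) (side s t (inj₁ b)) (side s t (inj₁ c)) (side s t (inj₁ d))
    crossCords-on-edge κ {s} {t} aₛₜ =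
      cong₂ _+ℚ_ (term a≢c) (cong₂ _+ℚ_ (term a≢d) (cong₂ _+ℚ_ (term b≢c) (cong (_+ℚ 0ℚ) (term b≢d))))
      where
      term : ∀ {x y} (x≢y : x ≢ y) →
        κ (cord x y x≢y) *ℚ lam T (cord x y x≢y) s t ≡
        κ (cord x y x≢y) *ℚ χ (side s t (inj₁ x) xor side s t (inj₁ y))
      term {x} {y} x≢y = cong (κ (cord x y x≢y) *ℚ_) (lam-cord aₛₜ x y x≢y)

    -- The pendant edges at a, b, c and an edge separating {a, c} from {b, d} force the coefficients
    -- α, β, γ, δ of ac, ad, bc, bd to satisfy α + β = γ + δ = α + γ = β + γ = 0.
    crossCords-independent : Disjoint (path (inj₁ a) (inj₁ c)) (path (inj₁ b) (inj₁ d)) → Independent T (crossCords D)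
    crossCords-independent ac∩bd≡∅ = crossCords-Unique D , vanishes
      where
      vanishes : ∀ κ → LinearRelation T κ (crossCords D) → ∀ xy → xy ∈ crossCords D → κ xy ≡ 0ℚ
      vanishes κ rel = λ where
          _ (here refl) → α≡0
          _ (there (here refl)) → +-cancelˡ-zero α+β≡0 α≡0
          _ (there (there (here refl))) → γ≡0
          _ (there (there (there (here refl)))) → +-cancelˡ-zero γ+δ≡0 γ≡0
        where
        α = κ (cord a c a≢c)
        β = κ (cord a d a≢d)
        γ = κ (cord b c b≢c)
        δ = κ (cord b d b≢d)
        at : ∀ {s t} → adj s t ≡ true → ∀ {sa sb sc sd} →
          side s t (inj₁ a) ≡ sa → side s t (inj₁ b) ≡ sb → side s t (inj₁ c) ≡ sc → side s t (inj₁ d) ≡ sd →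
          crossForm α β γ δ sa sb sc sd ≡ 0ℚ
        at aₛₜ refl refl refl refl = trans (sym (crossCords-on-edge κ aₛₜ)) (rel _ _ aₛₜ)
        α+β≡0 : α +ℚ β ≡ 0ℚ
        α+β≡0 with pendant-edge a≢b
        ... | _ , _ , aₛₜ , t∉a , toward = trans (sym (crossForm-FTTT α β γ δ))
          (at aₛₜ (side-∉ t∉a) (side-∈ (toward (≢-sym a≢b)))
                  (side-∈ (toward (≢-sym a≢c))) (side-∈ (toward (≢-sym a≢d))))
        γ+δ≡0 : γ +ℚ δ ≡ 0ℚ
        γ+δ≡0 with pendant-edge (≢-sym a≢b)
        ... | _ , _ , aₛₜ , t∉b , toward = trans (sym (crossForm-TFTT α β γ δ))
          (at aₛₜ (side-∈ (toward a≢b)) (side-∉ t∉b)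
                  (side-∈ (toward (≢-sym b≢c))) (side-∈ (toward (≢-sym b≢d))))
        α+γ≡0 : α +ℚ γ ≡ 0ℚ
        α+γ≡0 with pendant-edge (≢-sym a≢c)
        ... | _ , _ , aₛₜ , t∉c , toward = trans (sym (crossForm-TTFT α β γ δ))
          (at aₛₜ (side-∈ (toward a≢c)) (side-∈ (toward b≢c)) (side-∉ t∉c) (side-∈ (toward (≢-sym c≢d))))
        β+γ≡0 : β +ℚ γ ≡ 0ℚ
        β+γ≡0 with separating-edge ac∩bd≡∅
        ... | _ , _ , aₛₜ , t∉a , t∉c , t∈b , t∈d = trans (sym (crossForm-FTFT α β γ δ))
          (at aₛₜ (side-∉ t∉a) (side-∈ t∈b) (side-∉ t∉c) (side-∈ t∈d))
        α≡0 : α ≡ 0ℚ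
        α≡0 = triangle-zero α+β≡0 α+γ≡0 β+γ≡0
        γ≡0 : γ ≡ 0ℚ
        γ≡0 = +-cancelˡ-zero α+γ≡0 α≡0

    -- With these weights the relation λ_ac − λ_ad − λ_bc + λ_bd vanishes on every edge that does
    -- not separate both a from b and c from d.
    private
      ε : Fin n → ℚ
      ε x = if does (x ≟ᶠ a) ∨ does (x ≟ᶠ c) then 1ℚ else -ℚ 1ℚ

      ε-a : ε a ≡ 1ℚ
      ε-a rewrite dec-true (a ≟ᶠ a) refl = refl

      ε-c : ε c ≡ 1ℚ
      ε-c rewrite dec-false (c ≟ᶠ a) (≢-sym a≢c) | dec-true (c ≟ᶠ c) refl = refl

      ε-b : ε b ≡ -ℚ 1ℚ
      ε-b rewrite dec-false (b ≟ᶠ a) (≢-sym a≢b) | dec-false (b ≟ᶠ c) b≢c = refl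

      ε-d : ε d ≡ -ℚ 1ℚ
      ε-d rewrite dec-false (d ≟ᶠ a) (≢-sym a≢d) | dec-false (d ≟ᶠ c) (≢-sym c≢d) = refl

    crossCords-dependent : (∃ λ v → v ∈ path (inj₁ a) (inj₁ c) × v ∈ path (inj₁ b) (inj₁ d)) →
      (∃ λ v → v ∈ path (inj₁ a) (inj₁ d) × v ∈ path (inj₁ b) (inj₁ c)) → ¬ Independent T (crossCords D)
    crossCords-dependent (v , v∈ac , v∈bd) (w , w∈ad , w∈bc) (_ , vanishes) =
      1≢0 (trans (sym κ-ac) (vanishes (weight ε) relation _ (here refl)))
      where
      κ-ac : weight ε (cord a c a≢c) ≡ 1ℚ
      κ-ac = trans (weight-cord ε a c a≢c) (cong₂ _*ℚ_ ε-a ε-c)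
      coefficients : ∀ {sa sb sc sd} →
        crossForm (weight ε (cord a c a≢c)) (weight ε (cord a d a≢d))
                  (weight ε (cord b c b≢c)) (weight ε (cord b d b≢d)) sa sb sc sd
        ≡ crossForm 1ℚ (-ℚ 1ℚ) (-ℚ 1ℚ) 1ℚ sa sb sc sd
      coefficients rewrite κ-ac | weight-cord ε a d a≢d | weight-cord ε b c b≢c | weight-cord ε b d b≢d
                         | ε-a | ε-b | ε-c | ε-d = refl
      balanced : ∀ {s t} → adj s t ≡ true →
        side s t (inj₁ a) ≡ side s t (inj₁ b) ⊎ side s t (inj₁ c) ≡ side s t (inj₁ d)
      balanced {s} {t} aₛₜ
        with side s t (inj₁ a) ≟ᵇ side s t (inj₁ b) | side s t (inj₁ c) ≟ᵇ side s t (inj₁ d)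
      ... | yes a~b | _ = inj₁ a~b
      ... | no _ | yes c~d = inj₂ c~d
      ... | no a≁b | no c≁d with Bool-pairing a≁b c≁d
      ... | inj₁ (a~c , b~d) = ⊥-elim (a≁b (trans (sym (side-convex aₛₜ a~c v∈ac)) (side-convex aₛₜ b~d v∈bd)))
      ... | inj₂ (a~d , b~c) = ⊥-elim (a≁b (trans (sym (side-convex aₛₜ a~d w∈ad)) (side-convex aₛₜ b~c w∈bc)))
      relation : LinearRelation T (weight ε) (crossCords D)
      relation s t aₛₜ =
        trans (crossCords-on-edge (weight ε) aₛₜ)
              (trans (coefficients {sa} {sb} {sc} {sd}) (crossForm-balanced {sa} {sb} {sc} {sd} (balanced aₛₜ)))
        where
        sa = side s t (inj₁ a)
        sb = side s t (inj₁ b)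
        sc = side s t (inj₁ c)
        sd = side s t (inj₁ d)

    independent⇒disjoint-pairing : Independent T (crossCords D) →
      Disjoint (path (inj₁ a) (inj₁ c)) (path (inj₁ b) (inj₁ d)) ⊎
      Disjoint (path (inj₁ a) (inj₁ d)) (path (inj₁ b) (inj₁ c))
    independent⇒disjoint-pairing indep
      with disjoint-or-meet _≟v_ (path (inj₁ a) (inj₁ c)) (path (inj₁ b) (inj₁ d))
         | disjoint-or-meet _≟v_ (path (inj₁ a) (inj₁ d)) (path (inj₁ b) (inj₁ c))
    ... | inj₁ ac∩bd≡∅ | _ = inj₁ ac∩bd≡∅
    ... | inj₂ _ | inj₁ ad∩bc≡∅ = inj₂ ad∩bc≡∅
    ... | inj₂ ac∩bd | inj₂ ad∩bc = ⊥-elim (crossCords-dependent ac∩bd ad∩bc indep)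

sumℚ-↭ : ∀ {xs ys} → xs ↭ ys → sumℚ xs ≡ sumℚ ys
sumℚ-↭ p = Permₛ.foldr-commMonoid ℚ-+.setoid ℚ-+.isCommutativeMonoid (↭⇒↭ₛ p)
  where module ℚ-+ = CommutativeMonoid +-0-commutativeMonoid

module Matroid {n : ℕ} where

  _≟ᶜ_ : DecidableEquality (Cord n)
  _≟ᶜ_ = ≡-dec (≡-dec _≟ᶠ_ _≟ᶠ_) λ p q → yes (<-irrelevant p q)

  Independent-resp-↭ : ∀ (T : XTree n) {I J} → I ↭ J → Unique J → Independent T I → Independent T J
  Independent-resp-↭ T I↭J !J (_ , vanishes) = !J , λ κ relation xy xy∈J →
    vanishes κ (λ s t a → trans (sumℚ-↭ (↭-map⁺ _ I↭J)) (relation s t a)) xy (∈-resp-↭ (↭-sym I↭J) xy∈J)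

  _∈ᵇ_ : Cord n → List (Cord n) → Bool
  xy ∈ᵇ I = does (member? _≟ᶜ_ xy I)

  ∈ᵇ⇒∈ : ∀ {xy I} → xy ∈ᵇ I ≡ true → xy ∈ I
  ∈ᵇ⇒∈ {xy} {I} eq with member? _≟ᶜ_ xy I
  ∈ᵇ⇒∈ _ | yes xy∈I = xy∈I
  ∈ᵇ⇒∈ () | no _

  -- I has rank |I| in T₁, hence in T₂, and an independent J ⊆ I of size |I| is a permutation of I.
  SameMatroid⇒Independent : ∀ {T₁ T₂ : XTree n} → SameMatroid T₁ T₂ →
    ∀ I → Independent T₁ I → Independent T₂ I
  SameMatroid⇒Independent {T₁} {T₂} same I indep₁ with proj₁ (same (_∈ᵇ I) (length I)) rank₁
    where
    rank₁ : HasRank T₁ (_∈ᵇ I) (length I)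
    rank₁ = (I , (λ xy → dec-true (member? _≟ᶜ_ xy I)) , indep₁ , refl) ,
            λ J J⊆I indepJ → Unique-⊆⇒length≤ {ys = I} (proj₁ indepJ) (∈ᵇ⇒∈ ∘ J⊆I _)
  ... | (J , J⊆I , indep₂ , |J|≡|I|) , _ =
    Independent-resp-↭ T₂ J↭I (proj₁ indep₁) indep₂
    where
    J↭I : J ↭ I
    J↭I = Unique-⊆-length≤⇒↭ (proj₁ indep₂) (∈ᵇ⇒∈ ∘ J⊆I _) (≤-reflexive (sym |J|≡|I|))

  Independent⇒SameMatroid : ∀ {T₁ T₂ : XTree n} → (∀ I → Independent T₁ I → Independent T₂ I) →
    (∀ I → Independent T₂ I → Independent T₁ I) → SameMatroid T₁ T₂
  Independent⇒SameMatroid {T₁} {T₂} indep₁₂ indep₂₁ L r =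
    transfer {T₁} {T₂} indep₁₂ indep₂₁ , transfer {T₂} {T₁} indep₂₁ indep₁₂
    where
    transfer : ∀ {T T′ : XTree n} → (∀ I → Independent T I → Independent T′ I) →
      (∀ I → Independent T′ I → Independent T I) → HasRank T L r → HasRank T′ L r
    transfer to from ((I , I⊆L , indep , |I|≡r) , maximal) =
      (I , I⊆L , to I indep , |I|≡r) , λ J J⊆L indepJ → maximal J J⊆L (from J indepJ)

LeafPathsDisjoint : ∀ {n} → XTree n → (p q x y : Fin n) → Set
LeafPathsDisjoint T p q x y = Disjoint (XTree.path T (inj₁ p) (inj₁ q)) (XTree.path T (inj₁ x) (inj₁ y))

module Transfer {n : ℕ} {T₁ T₂ : XTree n} where
  private
    module P₁ = Paths T₁
    module P₂ = Paths T₂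
    module L₁ = Leaves T₁
    module L₂ = Leaves T₂
    module S₂ = Sides T₂
    module Q₁ = Quartets T₁
    module Q₂ = Quartets T₂
  open Cords

  -- For distinct leaves, the paths p–q and x–y are disjoint iff the cords joining {p, x} to {q, y}
  -- and those joining {p, y} to {q, x} are both independent.
  LeafPathsDisjoint-transfer : (∀ I → Independent T₁ I → Independent T₂ I) →
    ∀ p q x y → LeafPathsDisjoint T₁ p q x y → LeafPathsDisjoint T₂ p q x y
  LeafPathsDisjoint-transfer indep p q x y disjoint₁ with p ≟ᶠ x | p ≟ᶠ y | q ≟ᶠ x | q ≟ᶠ y
  ... | yes refl | _ | _ | _ = ⊥-elim (disjoint₁ (P₁.∈-path-start _ _ , P₁.∈-path-start _ _))
  ... | no _ | yes refl | _ | _ = ⊥-elim (disjoint₁ (P₁.∈-path-start _ _ , P₁.∈-path-end _ _))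
  ... | no _ | no _ | yes refl | _ = ⊥-elim (disjoint₁ (P₁.∈-path-end _ _ , P₁.∈-path-start _ _))
  ... | no _ | no _ | no _ | yes refl = ⊥-elim (disjoint₁ (P₁.∈-path-end _ _ , P₁.∈-path-end _ _))
  ... | no p≢x | no p≢y | no q≢x | no q≢y with p ≟ᶠ q | x ≟ᶠ y
  ...   | yes refl | _ = L₂.leaf-path-self-disjoint p≢x p≢y
  ...   | no _ | yes refl = Disjoint-sym (L₂.leaf-path-self-disjoint (≢-sym p≢x) (≢-sym q≢x))
  ...   | no p≢q | no x≢y
    with Q₂.independent⇒disjoint-pairing D (indep _ (Q₁.crossCords-independent D disjoint₁))
       | Q₂.independent⇒disjoint-pairing D′
           (indep _ (Q₁.crossCords-independent D′ (P₁.Disjoint-path-symʳ disjoint₁)))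
    where
    D : Distinct₄ p x q y
    D = record { a≢b = p≢x ; a≢c = p≢q ; a≢d = p≢y ; b≢c = ≢-sym q≢x ; b≢d = x≢y ; c≢d = q≢y }
    D′ : Distinct₄ p y q x
    D′ = record { a≢b = p≢y ; a≢c = p≢q ; a≢d = p≢x ; b≢c = ≢-sym q≢y ; b≢d = ≢-sym x≢y ; c≢d = q≢x }
  ...     | inj₁ pq∩xy≡∅ | _ = pq∩xy≡∅
  ...     | inj₂ _ | inj₁ pq∩yx≡∅ = P₂.Disjoint-path-symʳ pq∩yx≡∅
  ...     | inj₂ py∩xq≡∅ | inj₂ px∩yq≡∅ = ⊥-elim (S₂.disjoint-pairing-unique py∩xq≡∅ px∩yq≡∅)

Between-leaf-transfer : ∀ {n} (T₁ T₂ : XTree n) {x p q} →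
  Leaves.Between T₁ (inj₁ x) p q → Leaves.Between T₂ (inj₁ x) p q
Between-leaf-transfer T₁ T₂ x∈ with Leaves.Between-leaf T₁ x∈
... | inj₁ refl = Paths.∈-path-start T₂ _ _
... | inj₂ refl = Paths.∈-path-end T₂ _ _

module Matching {n : ℕ} (x₀ : Fin n) {T₁ T₂ : XTree n}
  (disjoint₁₂ : ∀ p q x y → LeafPathsDisjoint T₁ p q x y → LeafPathsDisjoint T₂ p q x y)
  (disjoint₂₁ : ∀ p q x y → LeafPathsDisjoint T₂ p q x y → LeafPathsDisjoint T₁ p q x y) where
  private
    module P₁ = Paths T₁
    module P₂ = Paths T₂
    module L₁ = Leaves T₁
    module L₂ = Leaves T₂

  SameBetween : P₁.V → P₂.V → Set
  SameBetween v w = ∀ p q → (L₁.Between v p q → L₂.Between w p q) × (L₂.Between w p q → L₁.Between v p q)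

  median-SameBetween : ∀ {i x y z w} →
    L₁.Between (inj₂ i) x y → L₁.Between (inj₂ i) y z → L₁.Between (inj₂ i) x z →
    L₂.Between w x y → L₂.Between w y z → L₂.Between w x z → SameBetween (inj₂ i) w
  median-SameBetween {i} {x} {y} {z} {w} i∈xy i∈yz i∈xz w∈xy w∈yz w∈xz p q = forward , backward
    where
    leaves-distinct : ∀ {a b} → L₁.Between (inj₂ i) a b → a ≢ b
    leaves-distinct i∈ refl with P₁.∈-path-self i∈
    ... | ()
    x≢y : x ≢ y
    x≢y = leaves-distinct i∈xy
    y≢z : y ≢ z
    y≢z = leaves-distinct i∈yz
    x≢z : x ≢ z
    x≢z = leaves-distinct i∈xz
    w≢leaf : ∀ {a b c} → a ≢ b → a ≢ c → L₂.Between w b c → w ≢ inj₁ a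
    w≢leaf a≢b a≢c w∈ refl = [ a≢b , a≢c ]′ (L₂.Between-leaf w∈)
    forward : L₁.Between (inj₂ i) p q → L₂.Between w p q
    forward i∈pq = P₂.∈-path-of-median w∈xy w∈yz w∈xz
      (w≢leaf x≢y x≢z w∈yz) (w≢leaf (≢-sym x≢y) y≢z w∈xz) (w≢leaf (≢-sym x≢z) (≢-sym y≢z) w∈xy) _ _
      (meets i∈xy) (meets i∈yz) (meets i∈xz)
      where
      meets : ∀ {a b} → L₁.Between (inj₂ i) a b → ¬ LeafPathsDisjoint T₂ p q a b
      meets i∈ab disjoint₂ = disjoint₂₁ p q _ _ disjoint₂ (i∈pq , i∈ab)
    backward : L₂.Between w p q → L₁.Between (inj₂ i) p q
    backward w∈pq = P₁.∈-path-of-median i∈xy i∈yz i∈xz (λ ()) (λ ()) (λ ()) _ _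
      (meets w∈xy) (meets w∈yz) (meets w∈xz)
      where
      meets : ∀ {a b} → L₂.Between w a b → ¬ LeafPathsDisjoint T₁ p q a b
      meets w∈ab disjoint₁ = disjoint₁₂ p q _ _ disjoint₁ (w∈pq , w∈ab)

  match : ∀ v → Σ P₂.V (SameBetween v)
  match (inj₁ x) = inj₁ x , λ p q → Between-leaf-transfer T₁ T₂ , Between-leaf-transfer T₂ T₁
  match (inj₂ i) =
    let x , y , z , i∈xy , i∈yz , i∈xz = L₁.interior-median x₀ i
        w , w∈xy , w∈yz , w∈xz = P₂.median (inj₁ x) (inj₁ y) (inj₁ z)
    in w , median-SameBetween i∈xy i∈yz i∈xz w∈xy w∈yz w∈xz

module BetweenPreserving {n : ℕ} {T₁ T₂ : XTree n}
  (φ : Paths.V T₁ → Paths.V T₂) (ψ : Paths.V T₂ → Paths.V T₁)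
  (ψ∘φ : ∀ v → ψ (φ v) ≡ v) (φ∘ψ : ∀ w → φ (ψ w) ≡ w)
  (φ-Between : ∀ {v p q} → Leaves.Between T₁ v p q → Leaves.Between T₂ (φ v) p q)
  (ψ-Between : ∀ {w p q} → Leaves.Between T₂ w p q → Leaves.Between T₁ (ψ w) p q) where
  private
    module P₁ = Paths T₁
    module P₂ = Paths T₂
    open XTree T₁ using () renaming (adj to adj₁)
    open XTree T₂ using () renaming (adj to adj₂)

  adjacency-preserved : ∀ {u v} → adj₁ u v ≡ true → adj₂ (φ u) (φ v) ≡ true
  adjacency-preserved {u} {v} aᵤᵥ with adj₂ (φ u) (φ v) ≟ᵇ true
  ... | yes a′ = a′
  ... | no ¬a′
    with P₂.step-toward (λ φu≡φv → P₁.adj⇒≢ aᵤᵥ (trans (sym (ψ∘φ u)) (trans (cong ψ φu≡φv) (ψ∘φ v))))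
  ...   | m , aₘ , m∈ = separated (Leaves.edge-separable T₁ aᵤᵥ ψm≢u ψm≢v)
    where
    ψm≢u : ψ m ≢ u
    ψm≢u refl = P₂.adj⇒≢ aₘ (φ∘ψ m)
    ψm≢v : ψ m ≢ v
    ψm≢v refl = ¬a′ (subst (λ w → adj₂ (φ u) w ≡ true) (sym (φ∘ψ m)) aₘ)
    separated : (∃₂ λ p q → Leaves.Between T₁ u p q × Leaves.Between T₁ v p q × ¬ Leaves.Between T₁ (ψ m) p q) →
      adj₂ (φ u) (φ v) ≡ true
    separated (p , q , u∈ , v∈ , ψm∉) =
      ⊥-elim (ψm∉ (ψ-Between (P₂.path-convex (φ-Between u∈) (φ-Between v∈) m∈)))

module Reconstruction {n : ℕ} (x₀ : Fin n) {T₁ T₂ : XTree n}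
  (indep₁₂ : ∀ I → Independent T₁ I → Independent T₂ I)
  (indep₂₁ : ∀ I → Independent T₂ I → Independent T₁ I) where
  private
    disjoint₁₂ : ∀ p q x y → LeafPathsDisjoint T₁ p q x y → LeafPathsDisjoint T₂ p q x y
    disjoint₁₂ = Transfer.LeafPathsDisjoint-transfer {T₁ = T₁} {T₂} indep₁₂
    disjoint₂₁ : ∀ p q x y → LeafPathsDisjoint T₂ p q x y → LeafPathsDisjoint T₁ p q x y
    disjoint₂₁ = Transfer.LeafPathsDisjoint-transfer {T₁ = T₂} {T₁} indep₂₁
    module M₁₂ = Matching x₀ {T₁} {T₂} disjoint₁₂ disjoint₂₁
    module M₂₁ = Matching x₀ {T₂} {T₁} disjoint₂₁ disjoint₁₂

  φ : Paths.V T₁ → Paths.V T₂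
  φ v = proj₁ (M₁₂.match v)

  ψ : Paths.V T₂ → Paths.V T₁
  ψ w = proj₁ (M₂₁.match w)

  φ-Between : ∀ {v p q} → Leaves.Between T₁ v p q → Leaves.Between T₂ (φ v) p q
  φ-Between {v} {p} {q} = proj₁ (proj₂ (M₁₂.match v) p q)

  ψ-Between : ∀ {w p q} → Leaves.Between T₂ w p q → Leaves.Between T₁ (ψ w) p q
  ψ-Between {w} {p} {q} = proj₁ (proj₂ (M₂₁.match w) p q)

  ψ∘φ : ∀ v → ψ (φ v) ≡ v
  ψ∘φ v = Leaves.Between-injective T₁
    (λ p q → proj₂ (proj₂ (M₁₂.match v) p q) ∘ proj₂ (proj₂ (M₂₁.match (φ v)) p q))
    (λ p q → ψ-Between ∘ φ-Between)

  φ∘ψ : ∀ w → φ (ψ w) ≡ w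
  φ∘ψ w = Leaves.Between-injective T₂
    (λ p q → proj₂ (proj₂ (M₂₁.match w) p q) ∘ proj₂ (proj₂ (M₁₂.match (ψ w)) p q))
    (λ p q → φ-Between ∘ ψ-Between)

  reconstruct : T₁ ≃T T₂
  reconstruct = ↔⇒⤖ (mk↔ₛ′ φ ψ φ∘ψ ψ∘φ) , (λ _ → refl) , λ u v → Bool-ext (reflect u v) (preserve u v)
    where
    open BetweenPreserving {T₁ = T₁} {T₂} φ ψ ψ∘φ φ∘ψ φ-Between ψ-Between
      renaming (adjacency-preserved to preserve′)
    open BetweenPreserving {T₁ = T₂} {T₁} ψ φ φ∘ψ ψ∘φ ψ-Between φ-Between
      renaming (adjacency-preserved to reflect′)
    preserve : ∀ u v → XTree.adj T₁ u v ≡ true → XTree.adj T₂ (φ u) (φ v) ≡ true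
    preserve u v = preserve′
    reflect : ∀ u v → XTree.adj T₂ (φ u) (φ v) ≡ true → XTree.adj T₁ u v ≡ true
    reflect u v = subst₂ (λ a b → XTree.adj T₁ a b ≡ true) (ψ∘φ u) (ψ∘φ v) ∘ reflect′

SameMatroid⇒≃T : ∀ {n} → Fin n → {T₁ T₂ : XTree n} → SameMatroid T₁ T₂ → T₁ ≃T T₂
SameMatroid⇒≃T x₀ {T₁} {T₂} same = Reconstruction.reconstruct x₀ {T₁} {T₂}
  (SameMatroid⇒Independent {T₁ = T₁} {T₂} same) (SameMatroid⇒Independent {T₁ = T₂} {T₁} (Product.swap ∘₂ same))
  where open Matroid

module Invariance {n : ℕ} {T₁ T₂ : XTree n} (iso : T₁ ≃T T₂) where
  private
    open XTree T₁ using () renaming (adj to adj₁; path to path₁)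
    open XTree T₂ using () renaming (adj to adj₂; path to path₂)
    f : Paths.V T₁ → Paths.V T₂
    f = Bijection.to (proj₁ iso)
    f-injective : ∀ {u v} → f u ≡ f v → u ≡ v
    f-injective = Bijection.injective (proj₁ iso)
    f-leaf : ∀ x → f (inj₁ x) ≡ inj₁ x
    f-leaf = proj₁ (proj₂ iso)
    f-adj : ∀ u v → adj₂ (f u) (f v) ≡ adj₁ u v
    f-adj = proj₂ (proj₂ iso)

  walk-map : ∀ {u v ws} → IsWalk adj₁ u v ws → IsWalk adj₂ (f u) (f v) (map f ws)
  walk-map walk-one = walk-one
  walk-map {u} (walk-cons {w = w} a W) = walk-cons (trans (f-adj u w) a) (walk-map W)

  path-map : ∀ u v → path₂ (f u) (f v) ≡ map f (path₁ u v)
  path-map u v = sym (Paths.≡-path T₂ (walk-map (Paths.path-walk T₁ u v)) (map⁺ f-injective (Paths.path-Unique T₁ u v)))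

  ≟-map : ∀ a u → ⌊ f a ≟v f u ⌋ ≡ ⌊ a ≟v u ⌋
  ≟-map a u with a ≟v u | f a ≟v f u
  ... | yes _ | yes _ = refl
  ... | no _ | no _ = refl
  ... | yes refl | no fa≢fa = ⊥-elim (fa≢fa refl)
  ... | no a≢u | yes fa≡fu = ⊥-elim (a≢u (f-injective fa≡fu))

  onList-map : ∀ a b L → onList (f a) (f b) (map f L) ≡ onList a b L
  onList-map a b [] = refl
  onList-map a b (u ∷ []) = refl
  onList-map a b (u ∷ w ∷ ws) =
    cong₂ _∨_ (cong₂ _∧_ (≟-map a u) (≟-map b w))
              (cong₂ _∨_ (cong₂ _∧_ (≟-map b u) (≟-map a w)) (onList-map a b (w ∷ ws)))

  lam-map : ∀ xy a b → lam T₂ xy (f a) (f b) ≡ lam T₁ xy a b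
  lam-map ((x , y) , _) a b
    rewrite sym (f-leaf x) | sym (f-leaf y) | path-map (inj₁ x) (inj₁ y)
          | onList-map a b (path₁ (inj₁ x) (inj₁ y)) = refl

  relation-map : ∀ (κ : Cord n → ℚ) I a b →
    sumℚ (map (λ xy → κ xy *ℚ lam T₂ xy (f a) (f b)) I) ≡ sumℚ (map (λ xy → κ xy *ℚ lam T₁ xy a b) I)
  relation-map κ I a b = cong sumℚ (map-cong (λ xy → cong (κ xy *ℚ_) (lam-map xy a b)) I)

  Independent-map : ∀ I → Independent T₁ I → Independent T₂ I
  Independent-map I (!I , vanishes) = !I , λ κ relation₂ →
    vanishes κ λ a b aₐ_b → trans (sym (relation-map κ I a b)) (relation₂ (f a) (f b) (trans (f-adj a b) aₐ_b))

  Independent-unmap : ∀ I → Independent T₂ I → Independent T₁ I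
  Independent-unmap I (!I , vanishes) = !I , λ κ relation₁ → vanishes κ (relation₂ κ relation₁)
    where
    relation₂ : ∀ κ → LinearRelation T₁ κ I → LinearRelation T₂ κ I
    relation₂ κ relation₁ a′ b′ a′ₐb′
      with Bijection.strictlySurjective (proj₁ iso) a′ | Bijection.strictlySurjective (proj₁ iso) b′
    ... | a , refl | b , refl = trans (relation-map κ I a b) (relation₁ a b (trans (sym (f-adj a b)) a′ₐb′))

≃T⇒SameMatroid : ∀ {n} {T₁ T₂ : XTree n} → T₁ ≃T T₂ → SameMatroid T₁ T₂
≃T⇒SameMatroid {T₁ = T₁} {T₂} iso =
  Matroid.Independent⇒SameMatroid {T₁ = T₁} {T₂} (Independent-map iso) (Independent-unmap iso)
  where open Invariance {T₁ = T₁} {T₂}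

theorem1 : (n : ℕ) → 3 ≤ n → (T₁ T₂ : XTree n) →
    (SameMatroid T₁ T₂ → T₁ ≃T T₂) × (T₁ ≃T T₂ → SameMatroid T₁ T₂)
-- 3 ≤ n is only needed to have a leaf at hand.
theorem1 (suc n) _ T₁ T₂ = SameMatroid⇒≃T zero {T₁} {T₂} , ≃T⇒SameMatroid {T₁ = T₁} {T₂}
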